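{- Let $\Sigma$ be a finite alphabet. For any $\delta>0$, $t,s\in\mathbb{N}$ and numbers $0<\rho_{i,j}(\sigma)\le1$ ($i=1,\dots,t$, $j=1,\dots,s$, $\sigma\in\Sigma$) there is $\varepsilon>0$ such that the following holds. Let $\mathcal{B}=\{B_{i,j}\}$ be a block partition of a $2$-dimensional matrix $A$ over $\Sigma$ into blocks $B_{i,j}$ of sizes $m_i\times n_j$, $i=1,\dots,t$, $j=1,\dots,s$, such that every $B_{i,j}$ is $\varepsilon$-regular and has density of each symbol $\sigma$ equal to $\rho_{i,j}(\sigma)$. Then for every $t\times s$ matrix $C=(c_{i,j})$ over $\Sigma$, the number of submatrices $C$ in $A$ is at least $$(1-\delta)\prod_{i=1}^t m_i\prod_{j=1}^s n_j\prod_{i=1}^t\prod_{j=1}^s\rho_{i,j}(c_{i,j}).$$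
   Context: A $2$-dimensional matrix over $\Sigma$ of sizes $m\times n$ is an $m\times n$ array with entries in $\Sigma$. A block is a submatrix (a choice of a set of rows and a set of columns). For a block $X$, $|X|$ is its number of entries and $\rho_\sigma(X)$ is the fraction of its entries equal to $\sigma$. A matrix $X$ of sizes $n^1\times n^2$ is $\varepsilon$-regular if for every $\sigma\in\Sigma$ and every block $Y$ of sizes $m^1\times m^2$ with $m^1\ge\varepsilon n^1$, $m^2\ge\varepsilon n^2$, $|\rho_\sigma(Y)-\rho_\sigma(X)|\le\varepsilon$. A block partition of $A$ into blocks $B_{i,j}$ of sizes $m_i\times n_j$ is given by partitioning the rows into sets $R_1,\dots,R_t$ with $|R_i|=m_i$ and the columns into sets $S_1,\dots,S_s$ with $|S_j|=n_j$, $B_{i,j}$ being the submatrix on $R_i\times S_j$. The number of submatrices $C$ in $A$ means the number of distinct submatrices of $A$ (choices of $t$ rows and $s$ columns) which can be obtained from $C$ by permutations of rows and columns.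
   Formalization: The parameter $\delta$ and the densities $\rho_{i,j}(\sigma)$ range over the rationals. -}

module Defs where

open import Data.Nat as ℕ using (ℕ; zero; suc)
open import Data.Integer using (+_)
open import Data.Rational as ℚ using (ℚ; _/_; 0ℚ; 1ℚ; ∣_∣)
open import Data.Fin using (Fin; zero; suc; _≟_)
open import Data.Fin.Subset using (Subset; _⊆_; _∈_; inside; outside)
import Data.Fin.Subset as Sub
open import Data.Vec using (Vec; lookup; tabulate)
open import Data.Bool using (Bool; true; false; if_then_else_; _∧_)
open import Data.List using (List; length)
open import Data.List.Relation.Unary.All using (All)
open import Data.List.Relation.Unary.Unique.Propositional using (Unique)
open import Data.Product using (Σ; ∃; _×_; _,_)
open import Relation.Binary.PropositionalEquality using (_≡_)
open import Relation.Nullary using (does)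
open import Function.Definitions using (Injective)

ℕtoℚ : ℕ → ℚ
ℕtoℚ n = (+ n) / 1

∑ : (n : ℕ) → (Fin n → ℕ) → ℕ
∑ zero    f = 0
∑ (suc n) f = f zero ℕ.+ ∑ n (λ i → f (suc i))

∏ℕ : (n : ℕ) → (Fin n → ℕ) → ℕ
∏ℕ zero    f = 1
∏ℕ (suc n) f = f zero ℕ.* ∏ℕ n (λ i → f (suc i))

∏ℚ : (n : ℕ) → (Fin n → ℚ) → ℚ
∏ℚ zero    f = 1ℚ
∏ℚ (suc n) f = f zero ℚ.* ∏ℚ n (λ i → f (suc i))

-- A matrix over the alphabet Σ = Fin k of sizes M × N
Matrix : ℕ → ℕ → ℕ → Set
Matrix k M N = Fin M → Fin N → Fin k

𝟙 : Bool → ℕ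
𝟙 true  = 1
𝟙 false = 0

countSym : ∀ {k M N} → Matrix k M N → Subset M → Subset N → Fin k → ℕ
countSym {M = M} {N} A P Q σ =
  ∑ M (λ r → ∑ N (λ c → 𝟙 (lookup P r ∧ lookup Q c ∧ does (A r c ≟ σ))))

-- ρ_σ(block P × Q): fraction of entries equal to σ (set to 0 for an empty block,
-- where the paper's density is undefined)
ratio : ℕ → ℕ → ℚ
ratio c zero    = 0ℚ
ratio c (suc d) = (+ c) / suc d

density : ∀ {k M N} → Matrix k M N → Subset M → Subset N → Fin k → ℚ
density A P Q σ = ratio (countSym A P Q σ) (Sub.∣ P ∣ ℕ.* Sub.∣ Q ∣)

Regular : ∀ {k M N} → ℚ → Matrix k M N → Subset M → Subset N → Set
Regular ε A P Q =
  ∀ σ (P' : Subset _) (Q' : Subset _) → P' ⊆ P → Q' ⊆ Q →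
  ε ℚ.* ℕtoℚ Sub.∣ P ∣ ℚ.≤ ℕtoℚ Sub.∣ P' ∣ →
  ε ℚ.* ℕtoℚ Sub.∣ Q ∣ ℚ.≤ ℕtoℚ Sub.∣ Q' ∣ →
  ∣ density A P' Q' σ ℚ.- density A P Q σ ∣ ℚ.≤ ε

-- the part of a partition of Fin M (given as a map to Fin t) with index i
part : ∀ {M t} → (Fin M → Fin t) → Fin t → Subset M
part f i = tabulate (λ r → does (f r ≟ i))

-- the submatrix of A on rows R and columns S (|R| = t, |S| = s) can be obtained
-- from the t × s matrix C by permuting rows and columns, i.e. there are
-- bijections Fin t → R and Fin s → S under which the entries agree
Occurs : ∀ {k M N t s} → Matrix k M N → Matrix k t s → Subset M → Subset N → Set
Occurs {t = t} {s} A C R S =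
  Sub.∣ R ∣ ≡ t × Sub.∣ S ∣ ≡ s ×
  Σ (Fin t → Fin _) λ f → Σ (Fin s → Fin _) λ g →
    Injective _≡_ _≡_ f × Injective _≡_ _≡_ g ×
    (∀ i → f i ∈ R) × (∀ j → g j ∈ S) ×
    (∀ i j → A (f i) (g j) ≡ C i j)

-- "the number of submatrices C in A is at least x":
-- there are distinct choices (R, S) of rows and columns, each an occurrence of C,
-- whose number is at least x
NumOccursAtLeast : ∀ {k M N t s} → Matrix k M N → Matrix k t s → ℚ → Set
NumOccursAtLeast {M = M} {N} A C x =
  ∃ λ (L : List (Subset M × Subset N)) →
    Unique L × All (λ RS → Occurs A C (Data.Product.proj₁ RS) (Data.Product.proj₂ RS)) L ×
    x ℚ.≤ ℕtoℚ (length L)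

-- Place C row by row, row i inside part i of the rows of A, and keep for every column j of C the
-- set of columns of part j of A that agree with C on the rows placed so far.  As long as such a
-- set has at least ε n_j columns, ε-regularity of the block (i, j) allows at most ε m_i rows of
-- part i to shrink it by more than the factor τ_ij = ρ_ij(c_ij) - 2ε; so at least (1 - sε) m_i
-- rows keep all s sets large, and the number of complete placements is at least
-- ∏_i (1 - sε) m_i · ∏_j n_j ∏_i τ_ij.  Placements are determined by their row and column sets,
-- since every row and column of C sits in its own part.  Finally ε is chosen so small that each
-- of the t + ts factors 1 - sε and τ_ij / ρ_ij(c_ij) is at least 1 - ζ with t (s + 1) ζ ≤ δ.

module Submission where

open import Defs
open import Data.Nat as ℕ using (ℕ; zero; suc)
import Data.Nat.Properties as ℕP
import Data.Nat.Tactic.RingSolver as ℕ-Solver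
import Data.Integer as ℤ
import Data.Integer.Properties as ℤP
import Data.Integer.Tactic.RingSolver as ℤ-Solver
open import Data.Rational as ℚ using (ℚ; 0ℚ; 1ℚ; _≤_; _<_; _+_; _*_; _-_; -_; _⊓_)
import Data.Rational.Properties as ℚP
import Data.Rational.Unnormalised as ℚᵘ
import Data.Rational.Unnormalised.Properties as ℚᵘP
open import Data.Fin using (Fin; zero; suc; _≟_)
import Data.Fin.Properties as FinP
open import Data.Fin.Properties using (all?; ¬∀⟶∃¬)
open import Data.Fin.Subset using (Subset; _⊆_; _∈_; ∣_∣)
open import Data.Vec using (Vec; []; _∷_; lookup; tabulate; head)
import Data.Vec.Properties as VecP
open import Data.Vec.Relation.Unary.Any using (Any; any?; index)
open import Data.Vec.Relation.Unary.Any.Properties using (lookup-index)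
open import Data.Vec.Membership.Propositional.Properties using (∈-lookup)
open import Data.List using (List; []; _∷_; _++_; length; map)
import Data.List.Properties as ListP
open import Data.List.Relation.Unary.All as All using (All; []; _∷_)
import Data.List.Relation.Unary.All.Properties as AllP
open import Data.List.Relation.Unary.AllPairs using ([]; _∷_)
import Data.List.Relation.Unary.AllPairs.Properties as AllPairsP
open import Data.List.Relation.Unary.Unique.Propositional using (Unique)
import Data.List.Relation.Unary.Unique.Propositional.Properties as UniqueP
open import Data.Bool using (Bool; true; false; if_then_else_; _∧_; _∨_; not)
open import Data.Bool.Properties using (∧-conicalˡ; ∧-conicalʳ; ∧-assoc; ∧-identityʳ; not-involutive)
open import Data.Product using (Σ; ∃; _×_; _,_; proj₁; proj₂)
open import Data.Sum using (inj₁; inj₂)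
open import Function.Base using (id)
open import Function.Definitions using (Injective)
open import Level using (0ℓ)
open import Relation.Nullary using (Dec; does; yes; no; ¬_)
open import Relation.Nullary.Decidable using (dec-true; dec-false; dec⇒maybe)
open import Relation.Binary.PropositionalEquality
open import Tactic.RingSolver using (solve-∀)
open import Tactic.RingSolver.Core.AlmostCommutativeRing using (AlmostCommutativeRing; fromCommutativeRing)

-- Rational arithmetic

-- The zero test lets the ring solver cancel terms such as a - a.
ℚ-ring : AlmostCommutativeRing 0ℓ 0ℓ
ℚ-ring = fromCommutativeRing ℚP.+-*-commutativeRing (λ x → dec⇒maybe (0ℚ ℚP.≟ x))

toℚᵘ-ℕtoℚ : ∀ n → ℚ.toℚᵘ (ℕtoℚ n) ℚᵘ.≃ ℚᵘ.mkℚᵘ (ℤ.+ n) 0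
toℚᵘ-ℕtoℚ n = ℚP.toℚᵘ-fromℚᵘ (ℚᵘ.mkℚᵘ (ℤ.+ n) 0)

ℕtoℚ-+ : ∀ m n → ℕtoℚ (m ℕ.+ n) ≡ ℕtoℚ m + ℕtoℚ n
ℕtoℚ-+ m n = ℚP.toℚᵘ-injective (begin-equality
  ℚ.toℚᵘ (ℕtoℚ (m ℕ.+ n))                 ≃⟨ toℚᵘ-ℕtoℚ (m ℕ.+ n) ⟩
  ℚᵘ.mkℚᵘ (ℤ.+ (m ℕ.+ n)) 0               ≃⟨ ℚᵘ.*≡* numerators ⟩
  ℚᵘ.mkℚᵘ (ℤ.+ m) 0 ℚᵘ.+ ℚᵘ.mkℚᵘ (ℤ.+ n) 0  ≃⟨ ℚᵘP.+-cong (toℚᵘ-ℕtoℚ m) (toℚᵘ-ℕtoℚ n) ⟨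
  ℚ.toℚᵘ (ℕtoℚ m) ℚᵘ.+ ℚ.toℚᵘ (ℕtoℚ n)    ≃⟨ ℚP.toℚᵘ-homo-+ (ℕtoℚ m) (ℕtoℚ n) ⟨
  ℚ.toℚᵘ (ℕtoℚ m + ℕtoℚ n)                ∎)
  where
  open ℚᵘP.≤-Reasoning
  identity : ∀ a b → (a ℤ.+ b) ℤ.* (ℤ.+ 1 ℤ.* ℤ.+ 1) ≡ (a ℤ.* ℤ.+ 1 ℤ.+ b ℤ.* ℤ.+ 1) ℤ.* ℤ.+ 1
  identity = ℤ-Solver.solve-∀
  numerators : ℤ.+ (m ℕ.+ n) ℤ.* (ℤ.+ 1 ℤ.* ℤ.+ 1) ≡ (ℤ.+ m ℤ.* ℤ.+ 1 ℤ.+ ℤ.+ n ℤ.* ℤ.+ 1) ℤ.* ℤ.+ 1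
  numerators = trans (cong (ℤ._* (ℤ.+ 1 ℤ.* ℤ.+ 1)) (ℤP.pos-+ m n)) (identity (ℤ.+ m) (ℤ.+ n))

ℕtoℚ-suc-* : ∀ n p → ℕtoℚ (suc n) * p ≡ p + ℕtoℚ n * p
ℕtoℚ-suc-* n p = trans (cong (_* p) (ℕtoℚ-+ 1 n)) (distrib (ℕtoℚ n) p)
  where
  distrib : ∀ a b → (1ℚ + a) * b ≡ b + a * b
  distrib = solve-∀ ℚ-ring

ℕtoℚ-* : ∀ m n → ℕtoℚ (m ℕ.* n) ≡ ℕtoℚ m * ℕtoℚ n
ℕtoℚ-* zero    n = sym (ℚP.*-zeroˡ (ℕtoℚ n))
ℕtoℚ-* (suc m) n = begin
  ℕtoℚ (n ℕ.+ m ℕ.* n)        ≡⟨ ℕtoℚ-+ n (m ℕ.* n) ⟩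
  ℕtoℚ n + ℕtoℚ (m ℕ.* n)     ≡⟨ cong (ℕtoℚ n +_) (ℕtoℚ-* m n) ⟩
  ℕtoℚ n + ℕtoℚ m * ℕtoℚ n    ≡⟨ ℕtoℚ-suc-* m (ℕtoℚ n) ⟨
  ℕtoℚ (suc m) * ℕtoℚ n       ∎
  where open ≡-Reasoning

ℕtoℚ-nonNeg : ∀ n → 0ℚ ≤ ℕtoℚ n
ℕtoℚ-nonNeg n = ℚP.nonNegative⁻¹ (ℕtoℚ n) {{ℚP.normalize-nonNeg n 1}}

p≤q⇒0≤q-p : ∀ {p q} → p ≤ q → 0ℚ ≤ q - p
p≤q⇒0≤q-p {p} {q} p≤q = begin
  0ℚ     ≡⟨ ℚP.+-inverseʳ p ⟨
  p - p  ≤⟨ ℚP.+-monoˡ-≤ (- p) p≤q ⟩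
  q - p  ∎
  where open ℚP.≤-Reasoning

≤-by-difference : ∀ {p q} r → q - p ≡ r → 0ℚ ≤ r → p ≤ q
≤-by-difference {p} {q} r q-p≡r 0≤r = begin
  p            ≡⟨ ℚP.+-identityˡ p ⟨
  0ℚ + p       ≤⟨ ℚP.+-monoˡ-≤ p 0≤r ⟩
  r + p        ≡⟨ cong (_+ p) q-p≡r ⟨
  q - p + p    ≡⟨ cancel q p ⟩
  q            ∎
  where
  open ℚP.≤-Reasoning
  cancel : ∀ a b → a - b + b ≡ a
  cancel = solve-∀ ℚ-ring

<-by-difference : ∀ {p q} r → q - p ≡ r → 0ℚ < r → p < q
<-by-difference {p} {q} r q-p≡r 0<r = begin-strict
  p            ≡⟨ ℚP.+-identityˡ p ⟨
  0ℚ + p       <⟨ ℚP.+-monoˡ-< p 0<r ⟩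
  r + p        ≡⟨ cong (_+ p) q-p≡r ⟨
  q - p + p    ≡⟨ cancel q p ⟩
  q            ∎
  where
  open ℚP.≤-Reasoning
  cancel : ∀ a b → a - b + b ≡ a
  cancel = solve-∀ ℚ-ring

+-nonNeg : ∀ {p q} → 0ℚ ≤ p → 0ℚ ≤ q → 0ℚ ≤ p + q
+-nonNeg {p} {q} 0≤p 0≤q = ℚP.+-mono-≤ 0≤p 0≤q

*-nonNeg : ∀ {p q} → 0ℚ ≤ p → 0ℚ ≤ q → 0ℚ ≤ p * q
*-nonNeg {p} {q} 0≤p 0≤q = ℚP.nonNegative⁻¹ (p * q)
  {{ℚP.nonNeg*nonNeg⇒nonNeg p {{ℚ.nonNegative 0≤p}} q {{ℚ.nonNegative 0≤q}}}}

*-pos : ∀ {p q} → 0ℚ < p → 0ℚ < q → 0ℚ < p * q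
*-pos {p} {q} 0<p 0<q = ℚP.positive⁻¹ (p * q)
  {{ℚP.pos*pos⇒pos p {{ℚ.positive 0<p}} q {{ℚ.positive 0<q}}}}

⊓-pos : ∀ {p q} → 0ℚ < p → 0ℚ < q → 0ℚ < p ⊓ q
⊓-pos {p} {q} 0<p 0<q with ℚP.≤-total p q
... | inj₁ p≤q = subst (0ℚ <_) (sym (ℚP.p≤q⇒p⊓q≡p p≤q)) 0<p
... | inj₂ q≤p = subst (0ℚ <_) (sym (ℚP.p≥q⇒p⊓q≡q q≤p)) 0<q

*-monoˡ-≤ : ∀ {p q} r → 0ℚ ≤ r → p ≤ q → r * p ≤ r * q
*-monoˡ-≤ r 0≤r = ℚP.*-monoˡ-≤-nonNeg r {{ℚ.nonNegative 0≤r}}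

*-monoʳ-≤ : ∀ {p q} r → 0ℚ ≤ r → p ≤ q → p * r ≤ q * r
*-monoʳ-≤ r 0≤r = ℚP.*-monoʳ-≤-nonNeg r {{ℚ.nonNegative 0≤r}}

*-mono-≤ : ∀ {p q r s} → 0ℚ ≤ p → 0ℚ ≤ s → p ≤ q → r ≤ s → p * r ≤ q * s
*-mono-≤ {p} {q} {r} {s} 0≤p 0≤s p≤q r≤s =
  ℚP.≤-trans (*-monoˡ-≤ p 0≤p r≤s) (*-monoʳ-≤ s 0≤s p≤q)

*-≤-1 : ∀ {p q} → 0ℚ ≤ p → p ≤ 1ℚ → q ≤ 1ℚ → p * q ≤ 1ℚ
*-≤-1 0≤p p≤1 q≤1 =
  ℚP.≤-trans (*-mono-≤ 0≤p (ℚP.≤-trans 0≤p p≤1) p≤1 q≤1) (ℚP.≤-reflexive (ℚP.*-identityˡ 1ℚ))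

p*q≤p : ∀ {p q} → 0ℚ ≤ p → q ≤ 1ℚ → p * q ≤ p
p*q≤p {p} 0≤p q≤1 = ℚP.≤-trans (*-monoˡ-≤ p 0≤p q≤1) (ℚP.≤-reflexive (ℚP.*-identityʳ p))

ℕtoℚ-mono-≤ : ∀ {m n} → m ℕ.≤ n → ℕtoℚ m ≤ ℕtoℚ n
ℕtoℚ-mono-≤ {m} {n} m≤n = ≤-by-difference (ℕtoℚ (n ℕ.∸ m)) difference (ℕtoℚ-nonNeg (n ℕ.∸ m))
  where
  cancel : ∀ a b → a + b - a ≡ b
  cancel = solve-∀ ℚ-ring
  difference : ℕtoℚ n - ℕtoℚ m ≡ ℕtoℚ (n ℕ.∸ m)
  difference = begin
    ℕtoℚ n - ℕtoℚ m                   ≡⟨ cong (λ k → ℕtoℚ k - ℕtoℚ m) (ℕP.m+[n∸m]≡n m≤n) ⟨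
    ℕtoℚ (m ℕ.+ (n ℕ.∸ m)) - ℕtoℚ m   ≡⟨ cong (_- ℕtoℚ m) (ℕtoℚ-+ m (n ℕ.∸ m)) ⟩
    ℕtoℚ m + ℕtoℚ (n ℕ.∸ m) - ℕtoℚ m  ≡⟨ cancel (ℕtoℚ m) (ℕtoℚ (n ℕ.∸ m)) ⟩
    ℕtoℚ (n ℕ.∸ m)                    ∎
    where open ≡-Reasoning

-p≤∣p∣ : ∀ p → - p ≤ ℚ.∣ p ∣
-p≤∣p∣ p with ℚP.∣p∣≡p∨∣p∣≡-p p
... | inj₂ ∣p∣≡-p = ℚP.≤-reflexive (sym ∣p∣≡-p)
... | inj₁ ∣p∣≡p  = ≤-by-difference (p + p) (trans (cong (_- - p) ∣p∣≡p) (double p))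
                      (+-nonNeg (ℚP.∣p∣≡p⇒0≤p ∣p∣≡p) (ℚP.∣p∣≡p⇒0≤p ∣p∣≡p))
  where
  double : ∀ a → a - - a ≡ a + a
  double = solve-∀ ℚ-ring

∣p-q∣≤r⇒q-r≤p : ∀ p q r → ℚ.∣ p - q ∣ ≤ r → q - r ≤ p
∣p-q∣≤r⇒q-r≤p p q r h = ≤-by-difference ((r - ℚ.∣ p - q ∣) + (ℚ.∣ p - q ∣ - - (p - q)))
  (rearrange p q r ℚ.∣ p - q ∣) (+-nonNeg (p≤q⇒0≤q-p h) (p≤q⇒0≤q-p (-p≤∣p∣ (p - q))))
  where
  rearrange : ∀ a b c d → a - (b - c) ≡ (c - d) + (d - - (a - b))
  rearrange = solve-∀ ℚ-ring

ratio*denominator : ∀ c d → ratio c (suc d) * ℕtoℚ (suc d) ≡ ℕtoℚ c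
ratio*denominator c d = ℚP.toℚᵘ-injective (begin-equality
  ℚ.toℚᵘ (ratio c (suc d) * ℕtoℚ (suc d))
    ≃⟨ ℚP.toℚᵘ-homo-* (ratio c (suc d)) (ℕtoℚ (suc d)) ⟩
  ℚ.toℚᵘ (ratio c (suc d)) ℚᵘ.* ℚ.toℚᵘ (ℕtoℚ (suc d))
    ≃⟨ ℚᵘP.*-cong (ℚP.toℚᵘ-fromℚᵘ (ℚᵘ.mkℚᵘ (ℤ.+ c) d)) (toℚᵘ-ℕtoℚ (suc d)) ⟩
  ℚᵘ.mkℚᵘ (ℤ.+ c) d ℚᵘ.* ℚᵘ.mkℚᵘ (ℤ.+ suc d) 0
    ≃⟨ ℚᵘ.*≡* (identity (ℤ.+ c) (ℤ.+ suc d)) ⟩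
  ℚᵘ.mkℚᵘ (ℤ.+ c) 0
    ≃⟨ toℚᵘ-ℕtoℚ c ⟨
  ℚ.toℚᵘ (ℕtoℚ c) ∎)
  where
  open ℚᵘP.≤-Reasoning
  identity : ∀ a b → (a ℤ.* b) ℤ.* ℤ.+ 1 ≡ a ℤ.* (b ℤ.* ℤ.+ 1)
  identity = ℤ-Solver.solve-∀

-- The hypothesis 0 ≤ x covers the junk value ratio c 0 = 0.
ratio≤ : ∀ c d {x} → 0ℚ ≤ x → ℕtoℚ c ≤ x * ℕtoℚ d → ratio c d ≤ x
ratio≤ c zero    0≤x _ = 0≤x
ratio≤ c (suc d) 0≤x c≤xd = ℚP.*-cancelʳ-≤-pos (ℕtoℚ (suc d)) {{ℚP.normalize-pos (suc d) 1}}
  (ℚP.≤-trans (ℚP.≤-reflexive (ratio*denominator c d)) c≤xd)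

1/suc : ℕ → ℚ
1/suc n = ratio 1 (suc n)

0<1/suc : ∀ n → 0ℚ < 1/suc n
0<1/suc n = ℚP.positive⁻¹ (1/suc n) {{ℚP.normalize-pos 1 (suc n)}}

0≤1/suc : ∀ n → 0ℚ ≤ 1/suc n
0≤1/suc n = ℚP.<⇒≤ (0<1/suc n)

suc*1/suc : ∀ n → ℕtoℚ (suc n) * 1/suc n ≡ 1ℚ
suc*1/suc n = trans (ℚP.*-comm (ℕtoℚ (suc n)) (1/suc n)) (ratio*denominator 1 n)

n*1/suc≤1 : ∀ n → ℕtoℚ n * 1/suc n ≤ 1ℚ
n*1/suc≤1 n = ℚP.≤-trans (*-monoʳ-≤ (1/suc n) (0≤1/suc n) (ℕtoℚ-mono-≤ {n} {suc n} (ℕP.n≤1+n n)))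
                         (ℚP.≤-reflexive (suc*1/suc n))

1/suc≤1 : ∀ n → 1/suc n ≤ 1ℚ
1/suc≤1 n = ratio≤ 1 (suc n) (ℕtoℚ-nonNeg 1)
  (ℚP.≤-trans (ℕtoℚ-mono-≤ {1} {suc n} (ℕ.s≤s ℕ.z≤n)) (ℚP.≤-reflexive (sym (ℚP.*-identityˡ (ℕtoℚ (suc n))))))

½ : ℚ
½ = 1/suc 1

½+½≡1 : ½ + ½ ≡ 1ℚ
½+½≡1 = refl

-- Finite sums and products

dec-true⁻¹ : ∀ {A : Set} (a? : Dec A) → does a? ≡ true → A
dec-true⁻¹ (yes a) _ = a

dec-false⁻¹ : ∀ {A : Set} (a? : Dec A) → does a? ≡ false → ¬ A
dec-false⁻¹ (no ¬a) _ = ¬a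

count : (n : ℕ) → (Fin n → Bool) → ℕ
count n b = ∑ n (λ r → 𝟙 (b r))

∑-cong : ∀ n {f g : Fin n → ℕ} → (∀ r → f r ≡ g r) → ∑ n f ≡ ∑ n g
∑-cong zero    f≗g = refl
∑-cong (suc n) f≗g = cong₂ ℕ._+_ (f≗g zero) (∑-cong n (λ r → f≗g (suc r)))

∑-distrib-+ : ∀ n (f g : Fin n → ℕ) → ∑ n (λ r → f r ℕ.+ g r) ≡ ∑ n f ℕ.+ ∑ n g
∑-distrib-+ zero    f g = refl
∑-distrib-+ (suc n) f g =
  trans (cong (f zero ℕ.+ g zero ℕ.+_) (∑-distrib-+ n (λ r → f (suc r)) (λ r → g (suc r))))
        (interchange (f zero) (g zero) (∑ n (λ r → f (suc r))) (∑ n (λ r → g (suc r))))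
  where
  interchange : ∀ a b c d → a ℕ.+ b ℕ.+ (c ℕ.+ d) ≡ a ℕ.+ c ℕ.+ (b ℕ.+ d)
  interchange = ℕ-Solver.solve-∀

∑-zero : ∀ n → ∑ n (λ _ → 0) ≡ 0
∑-zero zero    = refl
∑-zero (suc n) = ∑-zero n

∑-comm : ∀ m n (f : Fin m → Fin n → ℕ) → ∑ m (λ a → ∑ n (f a)) ≡ ∑ n (λ b → ∑ m (λ a → f a b))
∑-comm zero    n f = sym (∑-zero n)
∑-comm (suc m) n f = trans (cong (∑ n (f zero) ℕ.+_) (∑-comm m n (λ a → f (suc a))))
  (sym (∑-distrib-+ n (f zero) (λ b → ∑ m (λ a → f (suc a) b))))

∑-mono-≤ : ∀ n {f g : Fin n → ℕ} → (∀ r → f r ℕ.≤ g r) → ∑ n f ℕ.≤ ∑ n g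
∑-mono-≤ zero    f≤g = ℕ.z≤n
∑-mono-≤ (suc n) f≤g = ℕP.+-mono-≤ (f≤g zero) (∑-mono-≤ n (λ r → f≤g (suc r)))

∑-if-const : ∀ n (b : Fin n → Bool) k → ∑ n (λ r → if b r then k else 0) ≡ count n b ℕ.* k
∑-if-const zero    b k = refl
∑-if-const (suc n) b k with b zero
... | true  = cong (k ℕ.+_) (∑-if-const n (λ r → b (suc r)) k)
... | false = ∑-if-const n (λ r → b (suc r)) k

term-≤-∑ : ∀ n (f : Fin n → ℕ) r → f r ℕ.≤ ∑ n f
term-≤-∑ (suc n) f zero    = ℕP.m≤m+n (f zero) _
term-≤-∑ (suc n) f (suc r) = ℕP.≤-trans (term-≤-∑ n (λ r → f (suc r)) r) (ℕP.m≤n+m _ (f zero))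

count-≤-all+∑ : ∀ m n (a : Fin m → Bool) {P : Fin m → Fin n → Set} (P? : ∀ r j → Dec (P r j)) →
  count m a ℕ.≤ count m (λ r → a r ∧ does (all? (P? r)))
                ℕ.+ ∑ n (λ j → count m (λ r → a r ∧ not (does (P? r j))))
count-≤-all+∑ m n a {P} P? = ℕP.≤-trans (∑-mono-≤ m pointwise) (ℕP.≤-reflexive (begin
  ∑ m (λ r → 𝟙 (a r ∧ does (all? (P? r))) ℕ.+ ∑ n (λ j → 𝟙 (a r ∧ not (does (P? r j)))))
    ≡⟨ ∑-distrib-+ m _ _ ⟩
  count m (λ r → a r ∧ does (all? (P? r))) ℕ.+ ∑ m (λ r → ∑ n (λ j → 𝟙 (a r ∧ not (does (P? r j)))))
    ≡⟨ cong (count m (λ r → a r ∧ does (all? (P? r))) ℕ.+_) (∑-comm m n _) ⟩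
  count m (λ r → a r ∧ does (all? (P? r))) ℕ.+ ∑ n (λ j → count m (λ r → a r ∧ not (does (P? r j)))) ∎))
  where
  open ≡-Reasoning
  pointwise : ∀ r → 𝟙 (a r) ℕ.≤ 𝟙 (a r ∧ does (all? (P? r)))
                               ℕ.+ ∑ n (λ j → 𝟙 (a r ∧ not (does (P? r j))))
  pointwise r with a r
  ... | false = ℕ.z≤n
  ... | true with does (all? (P? r)) in all-eq
  ...   | true  = ℕP.m≤m+n 1 _
  ...   | false with ¬∀⟶∃¬ n (P r) (P? r) (dec-false⁻¹ (all? (P? r)) all-eq)
  ...     | j , ¬Prj = ℕP.≤-trans (ℕP.≤-reflexive (cong (λ b → 𝟙 (not b)) (sym (dec-false (P? r j) ¬Prj))))
                              (term-≤-∑ n (λ j → 𝟙 (not (does (P? r j)))) j)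

ℕtoℚ-∑-≤ : ∀ n (x : Fin n → ℕ) {y} → (∀ r → ℕtoℚ (x r) ≤ y) → ℕtoℚ (∑ n x) ≤ ℕtoℚ n * y
ℕtoℚ-∑-≤ zero    x {y} x≤y = ℚP.≤-reflexive (sym (ℚP.*-zeroˡ y))
ℕtoℚ-∑-≤ (suc n) x {y} x≤y = begin
  ℕtoℚ (x zero ℕ.+ S)     ≡⟨ ℕtoℚ-+ (x zero) S ⟩
  ℕtoℚ (x zero) + ℕtoℚ S  ≤⟨ ℚP.+-mono-≤ (x≤y zero) (ℕtoℚ-∑-≤ n (λ r → x (suc r)) (λ r → x≤y (suc r))) ⟩
  y + ℕtoℚ n * y          ≡⟨ ℕtoℚ-suc-* n y ⟨
  ℕtoℚ (suc n) * y        ∎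
  where
  open ℚP.≤-Reasoning
  S : ℕ
  S = ∑ n (λ r → x (suc r))

∑-if-≤-count* : ∀ n (b : Fin n → Bool) (x : Fin n → ℕ) {y} → (∀ r → b r ≡ true → ℕtoℚ (x r) ≤ y) →
  ℕtoℚ (∑ n (λ r → if b r then x r else 0)) ≤ ℕtoℚ (count n b) * y
∑-if-≤-count* zero    b x {y} _ = ℚP.≤-reflexive (sym (ℚP.*-zeroˡ y))
∑-if-≤-count* (suc n) b x {y} x≤y with b zero in b₀
... | false = ∑-if-≤-count* n (λ r → b (suc r)) (λ r → x (suc r)) (λ r → x≤y (suc r))
... | true  = begin
  ℕtoℚ (x zero ℕ.+ S)     ≡⟨ ℕtoℚ-+ (x zero) S ⟩
  ℕtoℚ (x zero) + ℕtoℚ S  ≤⟨ ℚP.+-mono-≤ (x≤y zero b₀)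
                               (∑-if-≤-count* n (λ r → b (suc r)) (λ r → x (suc r)) (λ r → x≤y (suc r))) ⟩
  y + ℕtoℚ K * y          ≡⟨ ℕtoℚ-suc-* K y ⟨
  ℕtoℚ (suc K) * y        ∎
  where
  open ℚP.≤-Reasoning
  S : ℕ
  S = ∑ n (λ r → if b (suc r) then x (suc r) else 0)
  K : ℕ
  K = count n (λ r → b (suc r))

count*-≤-∑ : ∀ n (b : Fin n → Bool) (x : Fin n → ℕ) {y} → (∀ r → b r ≡ true → y ≤ ℕtoℚ (x r)) →
  ℕtoℚ (count n b) * y ≤ ℕtoℚ (∑ n x)
count*-≤-∑ zero    b x {y} _ = ℚP.≤-reflexive (ℚP.*-zeroˡ y)
count*-≤-∑ (suc n) b x {y} y≤x with b zero in b₀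
... | false = ℚP.≤-trans (count*-≤-∑ n (λ r → b (suc r)) (λ r → x (suc r)) (λ r → y≤x (suc r)))
                         (ℕtoℚ-mono-≤ (ℕP.m≤n+m _ (x zero)))
... | true  = begin
  ℕtoℚ (suc K) * y        ≡⟨ ℕtoℚ-suc-* K y ⟩
  y + ℕtoℚ K * y          ≤⟨ ℚP.+-mono-≤ (y≤x zero b₀)
                               (count*-≤-∑ n (λ r → b (suc r)) (λ r → x (suc r)) (λ r → y≤x (suc r))) ⟩
  ℕtoℚ (x zero) + ℕtoℚ S  ≡⟨ ℕtoℚ-+ (x zero) S ⟨
  ℕtoℚ (x zero ℕ.+ S)     ∎
  where
  open ℚP.≤-Reasoning
  S : ℕ
  S = ∑ n (λ r → x (suc r))
  K : ℕ
  K = count n (λ r → b (suc r))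

∏ℚ-cong : ∀ n {f g : Fin n → ℚ} → (∀ r → f r ≡ g r) → ∏ℚ n f ≡ ∏ℚ n g
∏ℚ-cong zero    f≗g = refl
∏ℚ-cong (suc n) f≗g = cong₂ _*_ (f≗g zero) (∏ℚ-cong n (λ r → f≗g (suc r)))

∏ℚ-const-1 : ∀ n → ∏ℚ n (λ _ → 1ℚ) ≡ 1ℚ
∏ℚ-const-1 zero    = refl
∏ℚ-const-1 (suc n) = trans (cong (1ℚ *_) (∏ℚ-const-1 n)) (ℚP.*-identityˡ 1ℚ)

∏ℚ-distrib-* : ∀ n (f g : Fin n → ℚ) → ∏ℚ n (λ r → f r * g r) ≡ ∏ℚ n f * ∏ℚ n g
∏ℚ-distrib-* zero    f g = sym (ℚP.*-identityˡ 1ℚ)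
∏ℚ-distrib-* (suc n) f g =
  trans (cong (f zero * g zero *_) (∏ℚ-distrib-* n (λ r → f (suc r)) (λ r → g (suc r))))
        (interchange (f zero) (g zero) (∏ℚ n (λ r → f (suc r))) (∏ℚ n (λ r → g (suc r))))
  where
  interchange : ∀ a b c d → a * b * (c * d) ≡ a * c * (b * d)
  interchange = solve-∀ ℚ-ring

∏ℚ-comm : ∀ m n (f : Fin m → Fin n → ℚ) → ∏ℚ m (λ a → ∏ℚ n (f a)) ≡ ∏ℚ n (λ b → ∏ℚ m (λ a → f a b))
∏ℚ-comm zero    n f = sym (∏ℚ-const-1 n)
∏ℚ-comm (suc m) n f = trans (cong (∏ℚ n (f zero) *_) (∏ℚ-comm m n (λ a → f (suc a))))
  (sym (∏ℚ-distrib-* n (f zero) (λ b → ∏ℚ m (λ a → f (suc a) b))))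

ℕtoℚ-∏ : ∀ n (f : Fin n → ℕ) → ℕtoℚ (∏ℕ n f) ≡ ∏ℚ n (λ r → ℕtoℚ (f r))
ℕtoℚ-∏ zero    f = refl
ℕtoℚ-∏ (suc n) f = trans (ℕtoℚ-* (f zero) (∏ℕ n (λ r → f (suc r))))
                         (cong (ℕtoℚ (f zero) *_) (ℕtoℚ-∏ n (λ r → f (suc r))))

∏ℚ-nonNeg : ∀ n {f : Fin n → ℚ} → (∀ r → 0ℚ ≤ f r) → 0ℚ ≤ ∏ℚ n f
∏ℚ-nonNeg zero    _   = ℕtoℚ-nonNeg 1
∏ℚ-nonNeg (suc n) 0≤f = *-nonNeg (0≤f zero) (∏ℚ-nonNeg n (λ r → 0≤f (suc r)))

∏ℚ-pos : ∀ n {f : Fin n → ℚ} → (∀ r → 0ℚ < f r) → 0ℚ < ∏ℚ n f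
∏ℚ-pos zero    _   = ℚP.positive⁻¹ 1ℚ
∏ℚ-pos (suc n) 0<f = *-pos (0<f zero) (∏ℚ-pos n (λ r → 0<f (suc r)))

∏ℚ-mono-≤ : ∀ n {f g : Fin n → ℚ} → (∀ r → 0ℚ ≤ f r) → (∀ r → f r ≤ g r) → ∏ℚ n f ≤ ∏ℚ n g
∏ℚ-mono-≤ zero    _   _   = ℚP.≤-refl
∏ℚ-mono-≤ (suc n) 0≤f f≤g = *-mono-≤ (0≤f zero)
  (∏ℚ-nonNeg n (λ r → ℚP.≤-trans (0≤f (suc r)) (f≤g (suc r))))
  (f≤g zero) (∏ℚ-mono-≤ n (λ r → 0≤f (suc r)) (λ r → f≤g (suc r)))

∏ℚ-≤-1 : ∀ n {f : Fin n → ℚ} → (∀ r → 0ℚ ≤ f r) → (∀ r → f r ≤ 1ℚ) → ∏ℚ n f ≤ 1ℚ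
∏ℚ-≤-1 n 0≤f f≤1 = ℚP.≤-trans (∏ℚ-mono-≤ n 0≤f f≤1) (ℚP.≤-reflexive (∏ℚ-const-1 n))

∏ℚ-≤-factor : ∀ n {f : Fin n → ℚ} → (∀ r → 0ℚ ≤ f r) → (∀ r → f r ≤ 1ℚ) → ∀ r → ∏ℚ n f ≤ f r
∏ℚ-≤-factor (suc n) 0≤f f≤1 zero = p*q≤p (0≤f zero) (∏ℚ-≤-1 n (λ r → 0≤f (suc r)) (λ r → f≤1 (suc r)))
∏ℚ-≤-factor (suc n) {f} 0≤f f≤1 (suc r) = begin
  f zero * ∏ℚ n (λ r → f (suc r))  ≡⟨ ℚP.*-comm (f zero) _ ⟩
  ∏ℚ n (λ r → f (suc r)) * f zero  ≤⟨ p*q≤p (∏ℚ-nonNeg n (λ r → 0≤f (suc r))) (f≤1 zero) ⟩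
  ∏ℚ n (λ r → f (suc r))           ≤⟨ ∏ℚ-≤-factor n (λ r → 0≤f (suc r)) (λ r → f≤1 (suc r)) r ⟩
  f (suc r)                        ∎
  where open ℚP.≤-Reasoning

weierstrass : ∀ n {a b : Fin n → ℚ} {η} → 0ℚ ≤ η → η ≤ 1ℚ → (∀ r → 0ℚ ≤ b r) →
  (∀ r → (1ℚ - η) * b r ≤ a r) → (1ℚ - ℕtoℚ n * η) * ∏ℚ n b ≤ ∏ℚ n a
weierstrass zero    {η = η} _ _ _ _ = ℚP.≤-reflexive (no-factors η)
  where
  no-factors : ∀ e → (1ℚ - 0ℚ * e) * 1ℚ ≡ 1ℚ
  no-factors = solve-∀ ℚ-ring
weierstrass (suc n) {a} {b} {η} 0≤η η≤1 0≤b a≥ = ≤-by-difference _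
  (trans (cong (λ m → a zero * A - (1ℚ - m * η) * (b zero * B)) (ℕtoℚ-+ 1 n))
         (expand (a zero) (b zero) A B (ℕtoℚ n) η))
  (+-nonNeg (+-nonNeg
    (*-nonNeg (p≤q⇒0≤q-p (a≥ zero)) 0≤A)
    (*-nonNeg (*-nonNeg 1-η≥0 (0≤b zero)) (p≤q⇒0≤q-p ih)))
    (*-nonNeg (*-nonNeg (*-nonNeg (ℕtoℚ-nonNeg n) 0≤η) 0≤η) (*-nonNeg (0≤b zero) 0≤B)))
  where
  A : ℚ
  A = ∏ℚ n (λ r → a (suc r))
  B : ℚ
  B = ∏ℚ n (λ r → b (suc r))
  1-η≥0 : 0ℚ ≤ 1ℚ - η
  1-η≥0 = p≤q⇒0≤q-p η≤1
  0≤a : ∀ r → 0ℚ ≤ a r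
  0≤a r = ℚP.≤-trans (*-nonNeg 1-η≥0 (0≤b r)) (a≥ r)
  0≤A : 0ℚ ≤ A
  0≤A = ∏ℚ-nonNeg n (λ r → 0≤a (suc r))
  0≤B : 0ℚ ≤ B
  0≤B = ∏ℚ-nonNeg n (λ r → 0≤b (suc r))
  ih : (1ℚ - ℕtoℚ n * η) * B ≤ A
  ih = weierstrass n 0≤η η≤1 (λ r → 0≤b (suc r)) (λ r → a≥ (suc r))
  expand : ∀ a₀ b₀ A B m e → a₀ * A - (1ℚ - (1ℚ + m) * e) * (b₀ * B)
         ≡ (a₀ - (1ℚ - e) * b₀) * A + ((1ℚ - e) * b₀) * (A - (1ℚ - m * e) * B) + ((m * e) * e) * (b₀ * B)
  expand = solve-∀ ℚ-ring

module _ {X : Set} where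

  concatFin : ∀ n → (Fin n → List X) → List X
  concatFin zero    f = []
  concatFin (suc n) f = f zero ++ concatFin n (λ r → f (suc r))

  length-concatFin : ∀ n (f : Fin n → List X) → length (concatFin n f) ≡ ∑ n (λ r → length (f r))
  length-concatFin zero    f = refl
  length-concatFin (suc n) f = trans (ListP.length-++ (f zero))
    (cong (length (f zero) ℕ.+_) (length-concatFin n (λ r → f (suc r))))

  All-concatFin : ∀ {P : X → Set} n (f : Fin n → List X) → (∀ r → All P (f r)) → All P (concatFin n f)
  All-concatFin zero    f _  = []
  All-concatFin (suc n) f ps = AllP.++⁺ (ps zero) (All-concatFin n (λ r → f (suc r)) (λ r → ps (suc r)))

  Unique-concatFin : ∀ {L : Set} n (f : Fin n → List X) (tag : X → L) (label : Fin n → L) →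
    Injective _≡_ _≡_ label → (∀ r → All (λ x → tag x ≡ label r) (f r)) →
    (∀ r → Unique (f r)) → Unique (concatFin n f)
  Unique-concatFin zero    f tag label _           _      _  = []
  Unique-concatFin (suc n) f tag label label-injective tagged unique =
    AllPairsP.++⁺ (unique zero)
      (Unique-concatFin n (λ r → f (suc r)) tag (λ r → label (suc r))
        (λ eq → FinP.suc-injective (label-injective eq)) (λ r → tagged (suc r)) (λ r → unique (suc r)))
      (All.map (λ x-tag → All.map (λ y-untagged x≡y → y-untagged (trans (cong tag (sym x≡y)) x-tag)) tail-untagged)
        (tagged zero))
    where
    tail-untagged : All (λ y → tag y ≢ label zero) (concatFin n (λ r → f (suc r)))
    tail-untagged = All-concatFin n (λ r → f (suc r)) (λ r → All.map
      (λ y-tag y-zero → FinP.0≢1+n (label-injective (trans (sym y-zero) y-tag))) (tagged (suc r)))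

when : ∀ {X : Set} → Bool → List X → List X
when b xs = if b then xs else []

length-when : ∀ {X : Set} b (xs : List X) → length (when b xs) ≡ (if b then length xs else 0)
length-when true  xs = refl
length-when false xs = refl

All-when : ∀ {X : Set} {P : X → Set} b {xs : List X} → (b ≡ true → All P xs) → All P (when b xs)
All-when true  ps = ps refl
All-when false ps = []

Unique-when : ∀ {X : Set} b {xs : List X} → Unique xs → Unique (when b xs)
Unique-when true  u = u
Unique-when false u = []

Unique-map-on : ∀ {X Y : Set} {P : X → Set} (f : X → Y) → (∀ {x y} → P x → P y → f x ≡ f y → x ≡ y) →
  ∀ {xs} → All P xs → Unique xs → Unique (map f xs)
Unique-map-on f injective-on []         []           = []
Unique-map-on f injective-on (px ∷ pxs) (x∉xs ∷ uxs) =
  AllP.map⁺ (apart pxs x∉xs) ∷ Unique-map-on f injective-on pxs uxs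
  where
  apart : ∀ {ys} → All _ ys → All (_ ≢_) ys → All (λ y → f _ ≢ f y) ys
  apart []         []             = []
  apart (py ∷ pys) (x≢y ∷ x≢ys) = (λ fx≡fy → x≢y (injective-on px py fx≡fy)) ∷ apart pys x≢ys

∣tabulate∣≡count : ∀ n (b : Fin n → Bool) → ∣ tabulate b ∣ ≡ count n b
∣tabulate∣≡count zero    b = refl
∣tabulate∣≡count (suc n) b with b zero
... | true  = cong suc (∣tabulate∣≡count n (λ r → b (suc r)))
... | false = ∣tabulate∣≡count n (λ r → b (suc r))

∈-tabulate⁻ : ∀ {n} (b : Fin n → Bool) {x} → x ∈ tabulate b → b x ≡ true
∈-tabulate⁻ b {x} x∈ = trans (sym (VecP.lookup∘tabulate b x)) (VecP.[]=⇒lookup x∈)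

∈-tabulate⁺ : ∀ {n} (b : Fin n → Bool) {x} → b x ≡ true → x ∈ tabulate b
∈-tabulate⁺ b {x} bx = VecP.lookup⇒[]= x _ (trans (VecP.lookup∘tabulate b x) bx)

image : ∀ {n d} → Vec (Fin n) d → Subset n
image xs = tabulate (λ x → does (any? (x ≟_) xs))

lookup∈image : ∀ {n d} (xs : Vec (Fin n) d) k → lookup xs k ∈ image xs
lookup∈image xs k = ∈-tabulate⁺ _ (dec-true (any? (_ ≟_) xs) (∈-lookup k xs))

∈image⇒lookup : ∀ {n d} (xs : Vec (Fin n) d) {x} → x ∈ image xs → Σ (Fin d) (λ k → x ≡ lookup xs k)
∈image⇒lookup xs {x} x∈ = index x∈xs , lookup-index x∈xs
  where
  x∈xs : Any (x ≡_) xs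
  x∈xs = dec-true⁻¹ (any? (x ≟_) xs) (∈-tabulate⁻ _ x∈)

count-≟ : ∀ n (y : Fin n) → count n (λ x → does (x ≟ y)) ≡ 1
count-≟ (suc n) zero    = cong suc (∑-zero n)
count-≟ (suc n) (suc y) = count-≟ n y

∣image∣ : ∀ {n d} (xs : Vec (Fin n) d) → Injective _≡_ _≡_ (lookup xs) → ∣ image xs ∣ ≡ d
∣image∣ {n} xs injective = trans (∣tabulate∣≡count n _) (count-member xs injective)
  where
  count-member : ∀ {d} (xs : Vec (Fin n) d) → Injective _≡_ _≡_ (lookup xs) →
    count n (λ x → does (any? (x ≟_) xs)) ≡ d
  count-member []       _         = ∑-zero n
  count-member (y ∷ ys) injective = trans (∑-cong n split) (trans (∑-distrib-+ n _ _)
    (cong₂ ℕ._+_ (count-≟ n y) (count-member ys (λ eq → FinP.suc-injective (injective eq)))))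
    where
    y∉ys : does (any? (y ≟_) ys) ≡ false
    y∉ys = dec-false (any? (y ≟_) ys) λ y∈ys → FinP.0≢1+n (injective (lookup-index y∈ys))
    split : ∀ x → 𝟙 (does (x ≟ y) ∨ does (any? (x ≟_) ys))
                ≡ 𝟙 (does (x ≟ y)) ℕ.+ 𝟙 (does (any? (x ≟_) ys))
    split x with x ≟ y
    ... | yes refl rewrite y∉ys = refl
    ... | no _                  = refl

module _ {n d} (label : Fin n → Fin d) where

  Labels : Vec (Fin n) d → Set
  Labels xs = ∀ k → label (lookup xs k) ≡ k

  Labels⇒injective : ∀ {xs} → Labels xs → Injective _≡_ _≡_ (lookup xs)
  Labels⇒injective labels {a} {b} eq = trans (sym (labels a)) (trans (cong label eq) (labels b))

  image-injective : ∀ {xs ys} → Labels xs → Labels ys → image xs ≡ image ys → xs ≡ ys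
  image-injective {xs} {ys} xs-labels ys-labels same-image =
    trans (sym (VecP.tabulate∘lookup xs)) (trans (VecP.tabulate-cong pointwise) (VecP.tabulate∘lookup ys))
    where
    pointwise : ∀ k → lookup xs k ≡ lookup ys k
    pointwise k with ∈image⇒lookup ys (subst (lookup xs k ∈_) same-image (lookup∈image xs k))
    ... | k′ , xs[k]≡ys[k′] = trans xs[k]≡ys[k′] (cong (lookup ys)
      (trans (sym (ys-labels k′)) (trans (cong label (sym xs[k]≡ys[k′])) (xs-labels k))))

-- Placements of C in A

choices : ∀ {N} s → (Fin s → Fin N → Bool) → List (Vec (Fin N) s)
choices         zero    allowed = [] ∷ []
choices {N = N} (suc s) allowed =
  concatFin N (λ c → when (allowed zero c) (map (c ∷_) (choices s (λ j → allowed (suc j)))))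

module _ {N : ℕ} where

  length-choices : ∀ s (allowed : Fin s → Fin N → Bool) →
    length (choices s allowed) ≡ ∏ℕ s (λ j → count N (allowed j))
  length-choices zero    allowed = refl
  length-choices (suc s) allowed = begin
    length (concatFin N (λ c → when (allowed zero c) (map (c ∷_) rest)))
      ≡⟨ length-concatFin N _ ⟩
    ∑ N (λ c → length (when (allowed zero c) (map (c ∷_) rest)))
      ≡⟨ ∑-cong N (λ c → trans (length-when (allowed zero c) (map (c ∷_) rest))
                               (cong (λ l → if allowed zero c then l else 0) (ListP.length-map (c ∷_) rest))) ⟩
    ∑ N (λ c → if allowed zero c then length rest else 0)
      ≡⟨ ∑-if-const N (allowed zero) (length rest) ⟩
    count N (allowed zero) ℕ.* length rest
      ≡⟨ cong (count N (allowed zero) ℕ.*_) (length-choices s (λ j → allowed (suc j))) ⟩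
    ∏ℕ (suc s) (λ j → count N (allowed j)) ∎
    where
    open ≡-Reasoning
    rest = choices s (λ j → allowed (suc j))

  choices-allowed : ∀ s (allowed : Fin s → Fin N → Bool) →
    All (λ cs → ∀ j → allowed j (lookup cs j) ≡ true) (choices s allowed)
  choices-allowed zero    allowed = (λ ()) ∷ []
  choices-allowed (suc s) allowed = All-concatFin N _ λ c → All-when (allowed zero c) λ c-allowed →
    AllP.map⁺ (All.map (λ rest-allowed → λ { zero → c-allowed ; (suc j) → rest-allowed j })
                       (choices-allowed s (λ j → allowed (suc j))))

  choices-unique : ∀ s (allowed : Fin s → Fin N → Bool) → Unique (choices s allowed)
  choices-unique zero    allowed = [] ∷ []
  choices-unique (suc s) allowed = Unique-concatFin N _ head id id
    (λ c → All-when (allowed zero c) (λ _ → AllP.map⁺ (All.universal (λ _ → refl) _)))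
    (λ c → Unique-when (allowed zero c) (UniqueP.map⁺ VecP.∷-injectiveʳ (choices-unique s (λ j → allowed (suc j)))))

module Placements {k M N t s : ℕ} (A : Matrix k M N) (rowOf : Fin M → Fin t) (colOf : Fin N → Fin s)
         (C : Matrix k t s) where

  -- For each column j of C, the columns of A it may still be placed at.
  Candidates : Set
  Candidates = Fin s → Fin N → Bool

  placeable : Candidates → Fin s → Fin N → Bool
  placeable K j c = does (colOf c ≟ j) ∧ K j c

  #placeable : Candidates → Fin s → ℕ
  #placeable K j = count N (placeable K j)

  restrict : Candidates → Fin M → Fin t → Candidates
  restrict K r i j c = K j c ∧ does (A r c ≟ C i j)

  Placement : ℕ → Set
  Placement d = Vec (Fin M) d × Vec (Fin N) s

  place-row : ∀ {d} → Fin M → Placement d → Placement (suc d)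
  place-row r (rs , cs) = r ∷ rs , cs

  place-row-injective : ∀ {d r} {p q : Placement d} → place-row r p ≡ place-row r q → p ≡ q
  place-row-injective {p = _ , _} {q = _ , _} refl = refl

  placements : ∀ d → (Fin d → Fin t) → Candidates → List (Placement d)
  placements zero    is K = map ([] ,_) (choices s (placeable K))
  placements (suc d) is K = concatFin M λ r → when (does (rowOf r ≟ is zero))
    (map (place-row r) (placements d (λ k → is (suc k)) (restrict K r (is zero))))

  record IsPlacement d (is : Fin d → Fin t) (K : Candidates) (p : Placement d) : Set where
    field
      row-part    : ∀ k → rowOf (lookup (proj₁ p) k) ≡ is k
      col-part    : ∀ j → colOf (lookup (proj₂ p) j) ≡ j
      col-allowed : ∀ j → K j (lookup (proj₂ p) j) ≡ true
      agrees      : ∀ k j → A (lookup (proj₁ p) k) (lookup (proj₂ p) j) ≡ C (is k) j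

  length-placements-zero : ∀ is K → length (placements zero is K) ≡ ∏ℕ s (#placeable K)
  length-placements-zero is K = trans (ListP.length-map _ (choices s (placeable K))) (length-choices s (placeable K))

  length-placements-suc : ∀ d is K → length (placements (suc d) is K) ≡
    ∑ M (λ r → if does (rowOf r ≟ is zero)
               then length (placements d (λ k → is (suc k)) (restrict K r (is zero))) else 0)
  length-placements-suc d is K = trans (length-concatFin M _) (∑-cong M λ r →
    trans (length-when (does (rowOf r ≟ is zero)) _)
          (cong (λ l → if does (rowOf r ≟ is zero) then l else 0) (ListP.length-map (place-row r) (rest r))))
    where
    rest : Fin M → List (Placement d)
    rest r = placements d (λ k → is (suc k)) (restrict K r (is zero))

  placements-valid : ∀ d is K → All (IsPlacement d is K) (placements d is K)
  placements-valid zero    is K = AllP.map⁺ (All.map (λ placeable-cs → record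
    { row-part    = λ ()
    ; col-part    = λ j → dec-true⁻¹ (colOf _ ≟ j) (∧-conicalˡ _ _ (placeable-cs j))
    ; col-allowed = λ j → ∧-conicalʳ _ _ (placeable-cs j)
    ; agrees      = λ () }) (choices-allowed s (placeable K)))
  placements-valid (suc d) is K = All-concatFin M _ λ r → All-when (does (rowOf r ≟ is zero)) λ r-part →
    AllP.map⁺ (All.map (λ valid → let open IsPlacement valid in record
      { row-part    = λ { zero → dec-true⁻¹ (rowOf r ≟ is zero) r-part ; (suc k) → row-part k }
      ; col-part    = col-part
      ; col-allowed = λ j → ∧-conicalˡ _ _ (col-allowed j)
      ; agrees      = λ { zero j → dec-true⁻¹ (A r _ ≟ C (is zero) j) (∧-conicalʳ _ _ (col-allowed j))
                        ; (suc k) → agrees k } })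
      (placements-valid d (λ k → is (suc k)) (restrict K r (is zero))))

  placements-unique : ∀ d is K → Unique (placements d is K)
  placements-unique zero    is K = UniqueP.map⁺ (cong proj₂) (choices-unique s (placeable K))
  placements-unique (suc d) is K = Unique-concatFin M _ (λ p → head (proj₁ p)) id id
    (λ r → All-when (does (rowOf r ≟ is zero)) (λ _ → AllP.map⁺ (All.universal (λ _ → refl) _)))
    (λ r → Unique-when (does (rowOf r ≟ is zero)) (UniqueP.map⁺ place-row-injective (placements-unique d _ _)))

-- Regular blocks

rowCount : ∀ {k M N} → Matrix k M N → Fin M → Subset N → Fin k → ℕ
rowCount {N = N} A r Q σ = ∑ N (λ c → 𝟙 (lookup Q c ∧ does (A r c ≟ σ)))

countSym-rows : ∀ {k M N} (A : Matrix k M N) (b : Fin M → Bool) Q σ →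
  countSym A (tabulate b) Q σ ≡ ∑ M (λ r → if b r then rowCount A r Q σ else 0)
countSym-rows {M = M} {N} A b Q σ = ∑-cong M row
  where
  row : ∀ r → ∑ N (λ c → 𝟙 (lookup (tabulate b) r ∧ lookup Q c ∧ does (A r c ≟ σ)))
            ≡ (if b r then rowCount A r Q σ else 0)
  row r rewrite VecP.lookup∘tabulate b r with b r
  ... | true  = refl
  ... | false = ∑-zero N

-- Otherwise the sparse rows and Q' span a block of σ-density at most τ < ρ_σ - ε that is large
-- enough for ε-regularity to apply.
few-sparse-rows : ∀ {k M N ε} {A : Matrix k M N} {P Q} σ {τ} → Regular ε A P Q →
  0ℚ ≤ τ → τ < density A P Q σ - ε → ∀ {Q'} → Q' ⊆ Q → ε * ℕtoℚ ∣ Q ∣ ≤ ℕtoℚ ∣ Q' ∣ →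
  (sparse : Fin M → Bool) → (∀ {r} → sparse r ≡ true → r ∈ P) →
  (∀ r → sparse r ≡ true → ℕtoℚ (rowCount A r Q' σ) ≤ τ * ℕtoℚ ∣ Q' ∣) →
  ℕtoℚ (count M sparse) ≤ ε * ℕtoℚ ∣ P ∣
few-sparse-rows {M = M} {ε = ε} {A} {P} {Q} σ {τ} regular 0≤τ τ<ρ-ε {Q'} Q'⊆Q large-Q'
                sparse sparse⊆P sparse-rows =
  ℚP.≮⇒≥ λ many-sparse →
    ℚP.<-irrefl refl (ℚP.<-≤-trans τ<ρ-ε (ℚP.≤-trans (ρ-ε≤density many-sparse) density≤τ))
  where
  P' : Subset M
  P' = tabulate sparse
  ∣P'∣ : ∣ P' ∣ ≡ count M sparse
  ∣P'∣ = ∣tabulate∣≡count M sparse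
  ρ-ε≤density : ε * ℕtoℚ ∣ P ∣ < ℕtoℚ (count M sparse) → density A P Q σ - ε ≤ density A P' Q' σ
  ρ-ε≤density many-sparse = ∣p-q∣≤r⇒q-r≤p _ _ ε
    (regular σ P' Q' (λ r∈P' → sparse⊆P (∈-tabulate⁻ sparse r∈P')) Q'⊆Q
      (subst (λ n → ε * ℕtoℚ ∣ P ∣ ≤ ℕtoℚ n) (sym ∣P'∣) (ℚP.<⇒≤ many-sparse)) large-Q')
  density≤τ : density A P' Q' σ ≤ τ
  density≤τ = ratio≤ (countSym A P' Q' σ) (∣ P' ∣ ℕ.* ∣ Q' ∣) 0≤τ (begin
    ℕtoℚ (countSym A P' Q' σ)
      ≡⟨ cong ℕtoℚ (countSym-rows A sparse Q' σ) ⟩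
    ℕtoℚ (∑ M (λ r → if sparse r then rowCount A r Q' σ else 0))
      ≤⟨ ∑-if-≤-count* M sparse _ sparse-rows ⟩
    ℕtoℚ (count M sparse) * (τ * ℕtoℚ ∣ Q' ∣)
      ≡⟨ swap (ℕtoℚ (count M sparse)) τ (ℕtoℚ ∣ Q' ∣) ⟩
    τ * (ℕtoℚ (count M sparse) * ℕtoℚ ∣ Q' ∣)
      ≡⟨ cong (λ n → τ * (ℕtoℚ n * ℕtoℚ ∣ Q' ∣)) ∣P'∣ ⟨
    τ * (ℕtoℚ ∣ P' ∣ * ℕtoℚ ∣ Q' ∣)
      ≡⟨ cong (τ *_) (ℕtoℚ-* ∣ P' ∣ ∣ Q' ∣) ⟨
    τ * ℕtoℚ (∣ P' ∣ ℕ.* ∣ Q' ∣) ∎)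
    where
    open ℚP.≤-Reasoning
    swap : ∀ a b c → a * (b * c) ≡ b * (a * c)
    swap = solve-∀ ℚ-ring

-- Greedy counting

NumOccursAtLeast-mono : ∀ {k M N t s} {A : Matrix k M N} {C : Matrix k t s} {x y} →
  x ≤ y → NumOccursAtLeast A C y → NumOccursAtLeast A C x
NumOccursAtLeast-mono x≤y (L , unique , occurs , y≤L) = L , unique , occurs , ℚP.≤-trans x≤y y≤L

module Greedy {k M N t s : ℕ} (A : Matrix k M N) (rowOf : Fin M → Fin t) (colOf : Fin N → Fin s)
  (C : Matrix k t s) (ε : ℚ) (τ : Fin t → Fin s → ℚ)
  (sε≤1 : ℕtoℚ s * ε ≤ 1ℚ) (0≤τ : ∀ i j → 0ℚ ≤ τ i j) (τ≤1 : ∀ i j → τ i j ≤ 1ℚ)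
  (τ<ρ-ε : ∀ i j → τ i j < density A (part rowOf i) (part colOf j) (C i j) - ε)
  (regular : ∀ i j → Regular ε A (part rowOf i) (part colOf j)) where

  open Placements A rowOf colOf C

  m : Fin t → ℚ
  m i = ℕtoℚ ∣ part rowOf i ∣

  n : Fin s → ℚ
  n j = ℕtoℚ ∣ part colOf j ∣

  #placeableℚ : Candidates → Fin s → ℚ
  #placeableℚ K j = ℕtoℚ (#placeable K j)

  β : ℚ
  β = 1ℚ - ℕtoℚ s * ε

  keeps? : ∀ i K r j → Dec (τ i j * #placeableℚ K j ≤ #placeableℚ (restrict K r i) j)
  keeps? i K r j = τ i j * #placeableℚ K j ℚP.≤? #placeableℚ (restrict K r i) j

  good : Fin t → Candidates → Fin M → Bool
  good i K r = does (rowOf r ≟ i) ∧ does (all? (keeps? i K r))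

  bad : Fin t → Candidates → Fin s → Fin M → Bool
  bad i K j r = does (rowOf r ≟ i) ∧ not (does (keeps? i K r j))

  rowCount-placeable : ∀ i K j r → rowCount A r (tabulate (placeable K j)) (C i j) ≡ #placeable (restrict K r i) j
  rowCount-placeable i K j r = ∑-cong N λ c → cong 𝟙
    (trans (cong (_∧ does (A r c ≟ C i j)) (VecP.lookup∘tabulate (placeable K j) c))
           (∧-assoc (does (colOf c ≟ j)) (K j c) (does (A r c ≟ C i j))))

  few-bad-rows : ∀ i K j → ε * n j ≤ #placeableℚ K j → ℕtoℚ (count M (bad i K j)) ≤ ε * m i
  few-bad-rows i K j large = few-sparse-rows {A = A} (C i j) (regular i j) (0≤τ i j) (τ<ρ-ε i j) Q'⊆Q
    (subst (λ x → ε * n j ≤ ℕtoℚ x) (sym (∣tabulate∣≡count N (placeable K j))) large)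
    (bad i K j) (λ r-bad → ∈-tabulate⁺ _ (∧-conicalˡ _ _ r-bad)) sparse
    where
    Q'⊆Q : tabulate (placeable K j) ⊆ part colOf j
    Q'⊆Q c∈Q' = ∈-tabulate⁺ _ (∧-conicalˡ _ _ (∈-tabulate⁻ _ c∈Q'))
    sparse : ∀ r → bad i K j r ≡ true →
      ℕtoℚ (rowCount A r (tabulate (placeable K j)) (C i j)) ≤ τ i j * ℕtoℚ ∣ tabulate (placeable K j) ∣
    sparse r r-bad rewrite rowCount-placeable i K j r | ∣tabulate∣≡count N (placeable K j) =
      ℚP.<⇒≤ (ℚP.≰⇒> (dec-false⁻¹ (keeps? i K r j)
        (trans (sym (not-involutive _)) (cong not (∧-conicalʳ _ _ r-bad)))))

  many-good-rows : ∀ i K → (∀ j → ε * n j ≤ #placeableℚ K j) → β * m i ≤ ℕtoℚ (count M (good i K))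
  many-good-rows i K large = ≤-by-difference ((G + X - m i) + (ℕtoℚ s * (ε * m i) - X))
    (rearrange G X (m i) (ℕtoℚ s) ε) (+-nonNeg (p≤q⇒0≤q-p m≤G+X) (p≤q⇒0≤q-p X≤sεm))
    where
    G : ℚ
    G = ℕtoℚ (count M (good i K))
    X : ℚ
    X = ℕtoℚ (∑ s (λ j → count M (bad i K j)))
    m≤G+X : m i ≤ G + X
    m≤G+X = ℚP.≤-trans (ℕtoℚ-mono-≤ union-bound)
      (ℚP.≤-reflexive (ℕtoℚ-+ (count M (good i K)) (∑ s (λ j → count M (bad i K j)))))
      where
      in-part : Fin M → Bool
      in-part r = does (rowOf r ≟ i)
      union-bound : ∣ part rowOf i ∣ ℕ.≤ count M (good i K) ℕ.+ ∑ s (λ j → count M (bad i K j))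
      union-bound = subst (ℕ._≤ count M (good i K) ℕ.+ ∑ s (λ j → count M (bad i K j)))
        (sym (∣tabulate∣≡count M in-part)) (count-≤-all+∑ M s in-part (keeps? i K))
    X≤sεm : X ≤ ℕtoℚ s * (ε * m i)
    X≤sεm = ℕtoℚ-∑-≤ s _ (λ j → few-bad-rows i K j (large j))
    rearrange : ∀ g x m s e → g - (1ℚ - s * e) * m ≡ (g + x - m) + (s * (e * m) - x)
    rearrange = solve-∀ ℚ-ring

  ∏τ : ∀ d → (Fin d → Fin t) → Fin s → ℚ
  ∏τ d is j = ∏ℚ d (λ k → τ (is k) j)

  ∏βm : ∀ d → (Fin d → Fin t) → ℚ
  ∏βm d is = ∏ℚ d (λ k → β * m (is k))

  0≤∏τ : ∀ d is j → 0ℚ ≤ ∏τ d is j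
  0≤∏τ d is j = ∏ℚ-nonNeg d (λ k → 0≤τ (is k) j)

  0≤∏βm : ∀ d is → 0ℚ ≤ ∏βm d is
  0≤∏βm d is = ∏ℚ-nonNeg d (λ k → *-nonNeg (p≤q⇒0≤q-p sε≤1) (ℕtoℚ-nonNeg ∣ part rowOf (is k) ∣))

  0≤#placeableℚ : ∀ K j → 0ℚ ≤ #placeableℚ K j
  0≤#placeableℚ K j = ℕtoℚ-nonNeg (#placeable K j)

  -- Row is 0 of C goes to one of the at least β m i good rows of its part; there the number of
  -- placeable columns for every j shrinks at most by the factor τ, which preserves the invariant.
  count-placements : ∀ d is K → (∀ j → ε * n j ≤ ∏τ d is j * #placeableℚ K j) →
    ∏βm d is * ∏ℚ s (λ j → ∏τ d is j * #placeableℚ K j) ≤ ℕtoℚ (length (placements d is K))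
  count-placements zero is K _ = ℚP.≤-reflexive (begin
    1ℚ * ∏ℚ s (λ j → 1ℚ * #placeableℚ K j)  ≡⟨ ℚP.*-identityˡ _ ⟩
    ∏ℚ s (λ j → 1ℚ * #placeableℚ K j)       ≡⟨ ∏ℚ-cong s (λ j → ℚP.*-identityˡ (#placeableℚ K j)) ⟩
    ∏ℚ s (#placeableℚ K)                    ≡⟨ ℕtoℚ-∏ s (#placeable K) ⟨
    ℕtoℚ (∏ℕ s (#placeable K))     ≡⟨ cong ℕtoℚ (length-placements-zero is K) ⟨
    ℕtoℚ (length (placements zero is K)) ∎)
    where open ≡-Reasoning
  count-placements (suc d) is K invariant = begin
    β * m i * ∏βm d is′ * Q
      ≡⟨ ℚP.*-assoc (β * m i) (∏βm d is′) Q ⟩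
    β * m i * (∏βm d is′ * Q)
      ≤⟨ *-monoʳ-≤ _ (*-nonNeg (0≤∏βm d is′) 0≤Q) (many-good-rows i K large) ⟩
    ℕtoℚ (count M (good i K)) * (∏βm d is′ * Q)
      ≤⟨ count*-≤-∑ M (good i K) _ good-row ⟩
    ℕtoℚ (∑ M (λ r → if does (rowOf r ≟ i) then length (placements d is′ (restrict K r i)) else 0))
      ≡⟨ cong ℕtoℚ (length-placements-suc d is K) ⟨
    ℕtoℚ (length (placements (suc d) is K)) ∎
    where
    open ℚP.≤-Reasoning
    i : Fin t
    i = is zero
    is′ : Fin d → Fin t
    is′ k = is (suc k)
    Q : ℚ
    Q = ∏ℚ s (λ j → ∏τ (suc d) is j * #placeableℚ K j)
    0≤Q : 0ℚ ≤ Q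
    0≤Q = ∏ℚ-nonNeg s (λ j → *-nonNeg (0≤∏τ (suc d) is j) (0≤#placeableℚ K j))
    large : ∀ j → ε * n j ≤ #placeableℚ K j
    large j = begin
      ε * n j                              ≤⟨ invariant j ⟩
      ∏τ (suc d) is j * #placeableℚ K j    ≤⟨ *-monoʳ-≤ _ (0≤#placeableℚ K j)
                                                (∏ℚ-≤-1 (suc d) (λ k → 0≤τ (is k) j) (λ k → τ≤1 (is k) j)) ⟩
      1ℚ * #placeableℚ K j                 ≡⟨ ℚP.*-identityˡ (#placeableℚ K j) ⟩
      #placeableℚ K j                      ∎
    good-row : ∀ r → good i K r ≡ true →
      ∏βm d is′ * Q ≤ ℕtoℚ (if does (rowOf r ≟ i) then length (placements d is′ (restrict K r i)) else 0)
    good-row r r-good rewrite ∧-conicalˡ (does (rowOf r ≟ i)) _ r-good =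
      ℚP.≤-trans (*-monoˡ-≤ (∏βm d is′) (0≤∏βm d is′) shrink)
                 (count-placements d is′ (restrict K r i) (λ j → ℚP.≤-trans (invariant j) (step j)))
      where
      keeps : ∀ j → τ i j * #placeableℚ K j ≤ #placeableℚ (restrict K r i) j
      keeps = dec-true⁻¹ (all? (keeps? i K r)) (∧-conicalʳ (does (rowOf r ≟ i)) _ r-good)
      step : ∀ j → ∏τ (suc d) is j * #placeableℚ K j ≤ ∏τ d is′ j * #placeableℚ (restrict K r i) j
      step j = begin
        τ i j * ∏τ d is′ j * #placeableℚ K j         ≡⟨ swap (τ i j) (∏τ d is′ j) (#placeableℚ K j) ⟩
        ∏τ d is′ j * (τ i j * #placeableℚ K j)       ≤⟨ *-monoˡ-≤ (∏τ d is′ j) (0≤∏τ d is′ j) (keeps j) ⟩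
        ∏τ d is′ j * #placeableℚ (restrict K r i) j  ∎
        where
        swap : ∀ a b c → a * b * c ≡ b * (a * c)
        swap = solve-∀ ℚ-ring
      shrink : Q ≤ ∏ℚ s (λ j → ∏τ d is′ j * #placeableℚ (restrict K r i) j)
      shrink = ∏ℚ-mono-≤ s (λ j → *-nonNeg (0≤∏τ (suc d) is j) (0≤#placeableℚ K j)) step

  unrestricted : Candidates
  unrestricted j c = true

  #placeable-unrestricted : ∀ j → #placeable unrestricted j ≡ ∣ part colOf j ∣
  #placeable-unrestricted j = trans (∑-cong N (λ c → cong 𝟙 (∧-identityʳ (does (colOf c ≟ j)))))
                                    (sym (∣tabulate∣≡count N (λ c → does (colOf c ≟ j))))

  occurrence : ∀ {p} → IsPlacement t id unrestricted p → Occurs A C (image (proj₁ p)) (image (proj₂ p))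
  occurrence {rs , cs} valid =
    ∣image∣ rs rs-injective , ∣image∣ cs cs-injective , lookup rs , lookup cs , rs-injective , cs-injective ,
    lookup∈image rs , lookup∈image cs , agrees
    where
    open IsPlacement valid
    rs-injective : Injective _≡_ _≡_ (lookup rs)
    rs-injective = Labels⇒injective rowOf {rs} row-part
    cs-injective : Injective _≡_ _≡_ (lookup cs)
    cs-injective = Labels⇒injective colOf {cs} col-part

  ∏m : ℚ
  ∏m = ℕtoℚ (∏ℕ t (λ i → ∣ part rowOf i ∣))

  ∏n : ℚ
  ∏n = ℕtoℚ (∏ℕ s (λ j → ∣ part colOf j ∣))

  placement-product : ∏βm t id * ∏ℚ s (λ j → ∏τ t id j * n j) ≡ ∏ℚ t (λ i → β * ∏ℚ s (τ i)) * ∏m * ∏n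
  placement-product = begin
    ∏ℚ t (λ i → β * m i) * ∏ℚ s (λ j → ∏τ t id j * n j)
      ≡⟨ cong₂ _*_ (∏ℚ-distrib-* t (λ _ → β) m) (∏ℚ-distrib-* s (∏τ t id) n) ⟩
    (∏ℚ t (λ _ → β) * ∏ℚ t m) * (∏ℚ s (∏τ t id) * ∏ℚ s n)
      ≡⟨ cong₂ (λ x y → (∏ℚ t (λ _ → β) * x) * (y * ∏ℚ s n)) (sym (ℕtoℚ-∏ t _)) (sym (∏ℚ-comm t s τ)) ⟩
    (∏ℚ t (λ _ → β) * ∏m) * (∏ℚ t (λ i → ∏ℚ s (τ i)) * ∏ℚ s n)
      ≡⟨ cong (λ y → (∏ℚ t (λ _ → β) * ∏m) * (∏ℚ t (λ i → ∏ℚ s (τ i)) * y)) (sym (ℕtoℚ-∏ s _)) ⟩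
    (∏ℚ t (λ _ → β) * ∏m) * (∏ℚ t (λ i → ∏ℚ s (τ i)) * ∏n)
      ≡⟨ regroup (∏ℚ t (λ _ → β)) ∏m (∏ℚ t (λ i → ∏ℚ s (τ i))) ∏n ⟩
    ∏ℚ t (λ _ → β) * ∏ℚ t (λ i → ∏ℚ s (τ i)) * ∏m * ∏n
      ≡⟨ cong (λ x → x * ∏m * ∏n) (∏ℚ-distrib-* t (λ _ → β) (λ i → ∏ℚ s (τ i))) ⟨
    ∏ℚ t (λ i → β * ∏ℚ s (τ i)) * ∏m * ∏n ∎
    where
    open ≡-Reasoning
    regroup : ∀ a b c d → (a * b) * (c * d) ≡ a * c * b * d
    regroup = solve-∀ ℚ-ring

  occurrences : (∀ j → ε ≤ ∏ℚ t (λ i → τ i j)) → NumOccursAtLeast A C (∏ℚ t (λ i → β * ∏ℚ s (τ i)) * ∏m * ∏n)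
  occurrences ε≤∏τ = map images all-placements ,
    Unique-map-on images images-injective valid (placements-unique t id unrestricted) ,
    AllP.map⁺ (All.map occurrence valid) ,
    enough
    where
    open ℚP.≤-Reasoning
    all-placements : List (Placement t)
    all-placements = placements t id unrestricted
    valid : All (IsPlacement t id unrestricted) all-placements
    valid = placements-valid t id unrestricted
    images : Placement t → Subset M × Subset N
    images (rs , cs) = image rs , image cs
    images-injective : ∀ {p q} → IsPlacement t id unrestricted p → IsPlacement t id unrestricted q →
      images p ≡ images q → p ≡ q
    images-injective p-valid q-valid eq = cong₂ _,_
      (image-injective rowOf (IsPlacement.row-part p-valid) (IsPlacement.row-part q-valid) (cong proj₁ eq))
      (image-injective colOf (IsPlacement.col-part p-valid) (IsPlacement.col-part q-valid) (cong proj₂ eq))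
    invariant : ∀ j → ε * n j ≤ ∏τ t id j * #placeableℚ unrestricted j
    invariant j rewrite #placeable-unrestricted j = *-monoʳ-≤ (n j) (ℕtoℚ-nonNeg ∣ part colOf j ∣) (ε≤∏τ j)
    enough : ∏ℚ t (λ i → β * ∏ℚ s (τ i)) * ∏m * ∏n ≤ ℕtoℚ (length (map images all-placements))
    enough = begin
      ∏ℚ t (λ i → β * ∏ℚ s (τ i)) * ∏m * ∏n
        ≡⟨ placement-product ⟨
      ∏βm t id * ∏ℚ s (λ j → ∏τ t id j * n j)
        ≡⟨ cong (∏βm t id *_) (∏ℚ-cong s (λ j → cong (λ c → ∏τ t id j * ℕtoℚ c) (#placeable-unrestricted j))) ⟨
      ∏βm t id * ∏ℚ s (λ j → ∏τ t id j * #placeableℚ unrestricted j)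
        ≤⟨ count-placements t id unrestricted invariant ⟩
      ℕtoℚ (length all-placements)
        ≡⟨ cong ℕtoℚ (ListP.length-map images all-placements) ⟨
      ℕtoℚ (length (map images all-placements)) ∎

-- Choice of ε

module Tolerance (k : ℕ) (δ : ℚ) (0<δ : 0ℚ < δ) (t s : ℕ) (ρ : Fin t → Fin s → Fin k → ℚ)
  (ρ-bounds : ∀ i j σ → 0ℚ < ρ i j σ × ρ i j σ ≤ 1ℚ) where

  0≤ρ : ∀ i j σ → 0ℚ ≤ ρ i j σ
  0≤ρ i j σ = ℚP.<⇒≤ (proj₁ (ρ-bounds i j σ))

  ρ≤1 : ∀ i j σ → ρ i j σ ≤ 1ℚ
  ρ≤1 i j σ = proj₂ (ρ-bounds i j σ)

  -- All densities lie in (0, 1], so their product bounds each of them from below.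
  c : ℚ
  c = ∏ℚ t (λ i → ∏ℚ s (λ j → ∏ℚ k (ρ i j)))

  0<c : 0ℚ < c
  0<c = ∏ℚ-pos t (λ i → ∏ℚ-pos s (λ j → ∏ℚ-pos k (λ σ → proj₁ (ρ-bounds i j σ))))

  private
    ρ-row : Fin t → Fin s → ℚ
    ρ-row i j = ∏ℚ k (ρ i j)
    ρ-block : Fin t → ℚ
    ρ-block i = ∏ℚ s (ρ-row i)
    0≤ρ-row : ∀ i j → 0ℚ ≤ ρ-row i j
    0≤ρ-row i j = ∏ℚ-nonNeg k (0≤ρ i j)
    ρ-row≤1 : ∀ i j → ρ-row i j ≤ 1ℚ
    ρ-row≤1 i j = ∏ℚ-≤-1 k (0≤ρ i j) (ρ≤1 i j)
    0≤ρ-block : ∀ i → 0ℚ ≤ ρ-block i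
    0≤ρ-block i = ∏ℚ-nonNeg s (0≤ρ-row i)
    ρ-block≤1 : ∀ i → ρ-block i ≤ 1ℚ
    ρ-block≤1 i = ∏ℚ-≤-1 s (0≤ρ-row i) (ρ-row≤1 i)

  c≤ρ : ∀ i j σ → c ≤ ρ i j σ
  c≤ρ i j σ = begin
    c           ≤⟨ ∏ℚ-≤-factor t 0≤ρ-block ρ-block≤1 i ⟩
    ρ-block i   ≤⟨ ∏ℚ-≤-factor s (0≤ρ-row i) (ρ-row≤1 i) j ⟩
    ρ-row i j   ≤⟨ ∏ℚ-≤-factor k (0≤ρ i j) (ρ≤1 i j) σ ⟩
    ρ i j σ     ∎
    where open ℚP.≤-Reasoning

  c≤1 : c ≤ 1ℚ
  c≤1 = ∏ℚ-≤-1 t 0≤ρ-block ρ-block≤1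

  0≤c : 0ℚ ≤ c
  0≤c = ℚP.<⇒≤ 0<c

  θ : ℚ
  θ = δ ⊓ ½

  0<θ : 0ℚ < θ
  0<θ = ⊓-pos 0<δ (0<1/suc 1)

  w : ℚ
  w = 1/suc t * 1/suc s

  0<w : 0ℚ < w
  0<w = *-pos (0<1/suc t) (0<1/suc s)

  w≤1 : w ≤ 1ℚ
  w≤1 = *-≤-1 (0≤1/suc t) (1/suc≤1 t) (1/suc≤1 s)

  sw≤1 : ℕtoℚ s * w ≤ 1ℚ
  sw≤1 = begin
    ℕtoℚ s * (1/suc t * 1/suc s)  ≡⟨ swap (ℕtoℚ s) (1/suc t) (1/suc s) ⟩
    1/suc t * (ℕtoℚ s * 1/suc s)  ≤⟨ *-≤-1 (0≤1/suc t) (1/suc≤1 t) (n*1/suc≤1 s) ⟩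
    1ℚ                            ∎
    where
    open ℚP.≤-Reasoning
    swap : ∀ a b c → a * (b * c) ≡ b * (a * c)
    swap = solve-∀ ℚ-ring

  -- ζ is the relative loss allowed per factor; t (s + 1) ζ ≤ δ.
  ζ : ℚ
  ζ = θ * w

  0<ζ : 0ℚ < ζ
  0<ζ = *-pos 0<θ 0<w

  0≤ζ : 0ℚ ≤ ζ
  0≤ζ = ℚP.<⇒≤ 0<ζ

  ζ≤½ : ζ ≤ ½
  ζ≤½ = ℚP.≤-trans (p*q≤p (ℚP.<⇒≤ 0<θ) w≤1) (ℚP.p⊓q≤q δ ½)

  ζ≤1 : ζ ≤ 1ℚ
  ζ≤1 = ℚP.≤-trans ζ≤½ (1/suc≤1 1)

  [1+s]ζ≡θ/[1+t] : ℕtoℚ (suc s) * ζ ≡ θ * 1/suc t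
  [1+s]ζ≡θ/[1+t] = begin
    ℕtoℚ (suc s) * (θ * (1/suc t * 1/suc s))   ≡⟨ regroup (ℕtoℚ (suc s)) θ (1/suc t) (1/suc s) ⟩
    θ * (1/suc t * (ℕtoℚ (suc s) * 1/suc s))   ≡⟨ cong (λ x → θ * (1/suc t * x)) (suc*1/suc s) ⟩
    θ * (1/suc t * 1ℚ)                         ≡⟨ cong (θ *_) (ℚP.*-identityʳ (1/suc t)) ⟩
    θ * 1/suc t                                ∎
    where
    open ≡-Reasoning
    regroup : ∀ n d a b → n * (d * (a * b)) ≡ d * (a * (n * b))
    regroup = solve-∀ ℚ-ring

  [1+s]ζ≤1 : ℕtoℚ (suc s) * ζ ≤ 1ℚ
  [1+s]ζ≤1 = begin
    ℕtoℚ (suc s) * ζ  ≡⟨ [1+s]ζ≡θ/[1+t] ⟩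
    θ * 1/suc t       ≤⟨ p*q≤p (ℚP.<⇒≤ 0<θ) (1/suc≤1 t) ⟩
    θ                 ≤⟨ ℚP.p⊓q≤q δ ½ ⟩
    ½                 ≤⟨ 1/suc≤1 1 ⟩
    1ℚ                ∎
    where open ℚP.≤-Reasoning

  t[1+s]ζ≤δ : ℕtoℚ t * (ℕtoℚ (suc s) * ζ) ≤ δ
  t[1+s]ζ≤δ = begin
    ℕtoℚ t * (ℕtoℚ (suc s) * ζ)  ≡⟨ cong (ℕtoℚ t *_) [1+s]ζ≡θ/[1+t] ⟩
    ℕtoℚ t * (θ * 1/suc t)       ≡⟨ swap (ℕtoℚ t) θ (1/suc t) ⟩
    θ * (ℕtoℚ t * 1/suc t)       ≤⟨ p*q≤p (ℚP.<⇒≤ 0<θ) (n*1/suc≤1 t) ⟩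
    θ                            ≤⟨ ℚP.p⊓q≤p δ ½ ⟩
    δ                            ∎
    where
    open ℚP.≤-Reasoning
    swap : ∀ a b c → a * (b * c) ≡ b * (a * c)
    swap = solve-∀ ℚ-ring

  ½c : ℚ
  ½c = ½ * c

  0<½c : 0ℚ < ½c
  0<½c = *-pos (0<1/suc 1) 0<c

  0≤½c : 0ℚ ≤ ½c
  0≤½c = ℚP.<⇒≤ 0<½c

  ½c≤1 : ½c ≤ 1ℚ
  ½c≤1 = *-≤-1 (0≤1/suc 1) (1/suc≤1 1) c≤1

  -- Every τ i j is at least ½ c, so every column product ∏_i τ i j is at least γ.
  γ : ℚ
  γ = ∏ℚ t (λ _ → ½c)

  0<γ : 0ℚ < γ
  0<γ = ∏ℚ-pos t (λ _ → 0<½c)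

  γ≤1 : γ ≤ 1ℚ
  γ≤1 = ∏ℚ-≤-1 t (λ _ → 0≤½c) (λ _ → ½c≤1)

  ε : ℚ
  ε = ζ * (w * (½c * γ))

  0<ε : 0ℚ < ε
  0<ε = *-pos 0<ζ (*-pos 0<w (*-pos 0<½c 0<γ))

  0≤ε : 0ℚ ≤ ε
  0≤ε = ℚP.<⇒≤ 0<ε

  sε≤ζ : ℕtoℚ s * ε ≤ ζ
  sε≤ζ = begin
    ℕtoℚ s * ε                     ≡⟨ regroup (ℕtoℚ s) ζ w (½c * γ) ⟩
    ζ * ((ℕtoℚ s * w) * (½c * γ))  ≤⟨ p*q≤p 0≤ζ (*-≤-1 (*-nonNeg (ℕtoℚ-nonNeg s) (ℚP.<⇒≤ 0<w)) sw≤1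
                                                        (*-≤-1 0≤½c ½c≤1 γ≤1)) ⟩
    ζ                              ∎
    where
    open ℚP.≤-Reasoning
    regroup : ∀ n z w x → n * (z * (w * x)) ≡ z * ((n * w) * x)
    regroup = solve-∀ ℚ-ring

  2ε≤ζc : ε + ε ≤ ζ * c
  2ε≤ζc = begin
    ε + ε                        ≡⟨ regroup ζ w ½ c γ ⟩
    ζ * c * ((½ + ½) * (w * γ))  ≡⟨ cong (λ x → ζ * c * (x * (w * γ))) ½+½≡1 ⟩
    ζ * c * (1ℚ * (w * γ))       ≡⟨ cong (ζ * c *_) (ℚP.*-identityˡ (w * γ)) ⟩
    ζ * c * (w * γ)              ≤⟨ p*q≤p (*-nonNeg 0≤ζ 0≤c) (*-≤-1 (ℚP.<⇒≤ 0<w) w≤1 γ≤1) ⟩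
    ζ * c                        ∎
    where
    open ℚP.≤-Reasoning
    regroup : ∀ z w h c g → z * (w * (h * c * g)) + z * (w * (h * c * g)) ≡ z * c * ((h + h) * (w * g))
    regroup = solve-∀ ℚ-ring

  ε≤γ : ε ≤ γ
  ε≤γ = begin
    ε                   ≡⟨ regroup ζ w ½c γ ⟩
    γ * (ζ * (w * ½c))  ≤⟨ p*q≤p (ℚP.<⇒≤ 0<γ) (*-≤-1 0≤ζ ζ≤1 (*-≤-1 (ℚP.<⇒≤ 0<w) w≤1 ½c≤1)) ⟩
    γ                   ∎
    where
    open ℚP.≤-Reasoning
    regroup : ∀ z w h g → z * (w * (h * g)) ≡ g * (z * (w * h))
    regroup = solve-∀ ℚ-ring

  τ : Fin t → Fin s → Fin k → ℚ
  τ i j σ = ρ i j σ - (ε + ε)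

  [1-ζ]ρ≤τ : ∀ i j σ → (1ℚ - ζ) * ρ i j σ ≤ τ i j σ
  [1-ζ]ρ≤τ i j σ = ≤-by-difference (ζ * (ρ i j σ - c) + (ζ * c - (ε + ε)))
    (rearrange (ρ i j σ) ζ c (ε + ε)) (+-nonNeg (*-nonNeg 0≤ζ (p≤q⇒0≤q-p (c≤ρ i j σ))) (p≤q⇒0≤q-p 2ε≤ζc))
    where
    rearrange : ∀ r z c e → r - e - (1ℚ - z) * r ≡ z * (r - c) + (z * c - e)
    rearrange = solve-∀ ℚ-ring

  ½≤1-ζ : ½ ≤ 1ℚ - ζ
  ½≤1-ζ = ≤-by-difference (½ - ζ) (trans (cong (λ x → x - ζ - ½) (sym ½+½≡1)) (cancel ½ ζ))
    (p≤q⇒0≤q-p ζ≤½)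
    where
    cancel : ∀ h z → h + h - z - h ≡ h - z
    cancel = solve-∀ ℚ-ring

  ½c≤τ : ∀ i j σ → ½c ≤ τ i j σ
  ½c≤τ i j σ = begin
    ½ * c               ≤⟨ *-monoʳ-≤ c 0≤c ½≤1-ζ ⟩
    (1ℚ - ζ) * c        ≤⟨ *-monoˡ-≤ (1ℚ - ζ) (p≤q⇒0≤q-p ζ≤1) (c≤ρ i j σ) ⟩
    (1ℚ - ζ) * ρ i j σ  ≤⟨ [1-ζ]ρ≤τ i j σ ⟩
    τ i j σ             ∎
    where open ℚP.≤-Reasoning

  0≤τ : ∀ i j σ → 0ℚ ≤ τ i j σ
  0≤τ i j σ = ℚP.≤-trans 0≤½c (½c≤τ i j σ)

  τ≤1 : ∀ i j σ → τ i j σ ≤ 1ℚ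
  τ≤1 i j σ =
    ℚP.≤-trans (≤-by-difference (ε + ε) (cancel (ρ i j σ) (ε + ε)) (+-nonNeg 0≤ε 0≤ε)) (ρ≤1 i j σ)
    where
    cancel : ∀ r e → r - (r - e) ≡ e
    cancel = solve-∀ ℚ-ring

  τ<ρ-ε : ∀ i j σ → τ i j σ < ρ i j σ - ε
  τ<ρ-ε i j σ = <-by-difference ε (cancel (ρ i j σ) ε) 0<ε
    where
    cancel : ∀ r e → r - e - (r - (e + e)) ≡ e
    cancel = solve-∀ ℚ-ring

  ε≤∏τ : ∀ (C : Matrix k t s) j → ε ≤ ∏ℚ t (λ i → τ i j (C i j))
  ε≤∏τ C j = ℚP.≤-trans ε≤γ (∏ℚ-mono-≤ t (λ _ → 0≤½c) (λ i → ½c≤τ i j (C i j)))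

  β : ℚ
  β = 1ℚ - ℕtoℚ s * ε

  sε≤1 : ℕtoℚ s * ε ≤ 1ℚ
  sε≤1 = ℚP.≤-trans sε≤ζ ζ≤1

  [1-ζ]≤β : (1ℚ - ζ) * 1ℚ ≤ β
  [1-ζ]≤β = ≤-by-difference (ζ - ℕtoℚ s * ε) (cancel ζ (ℕtoℚ s * ε)) (p≤q⇒0≤q-p sε≤ζ)
    where
    cancel : ∀ z x → 1ℚ - x - (1ℚ - z) * 1ℚ ≡ z - x
    cancel = solve-∀ ℚ-ring

  -- The product of the t + ts factors β and τ i j loses at most the fraction t (s + 1) ζ ≤ δ.
  product-bound : ∀ (C : Matrix k t s) →
    (1ℚ - δ) * ∏ℚ t (λ i → ∏ℚ s (λ j → ρ i j (C i j))) ≤ ∏ℚ t (λ i → β * ∏ℚ s (λ j → τ i j (C i j)))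
  product-bound C = begin
    (1ℚ - δ) * Z
      ≤⟨ *-monoʳ-≤ Z (∏ℚ-nonNeg t 0≤Zᵢ) 1-δ≤1-tη ⟩
    (1ℚ - ℕtoℚ t * η) * Z
      ≡⟨ cong ((1ℚ - ℕtoℚ t * η) *_) (∏ℚ-cong t (λ i → ℚP.*-identityˡ _)) ⟨
    (1ℚ - ℕtoℚ t * η) * ∏ℚ t (λ i → 1ℚ * ∏ℚ s (λ j → ρ i j (C i j)))
      ≤⟨ weierstrass t (*-nonNeg (ℕtoℚ-nonNeg (suc s)) 0≤ζ) [1+s]ζ≤1
                       (λ i → *-nonNeg (ℕtoℚ-nonNeg 1) (0≤Zᵢ i)) row-bound ⟩
    ∏ℚ t (λ i → β * ∏ℚ s (λ j → τ i j (C i j))) ∎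
    where
    open ℚP.≤-Reasoning
    Z : ℚ
    Z = ∏ℚ t (λ i → ∏ℚ s (λ j → ρ i j (C i j)))
    0≤Zᵢ : ∀ i → 0ℚ ≤ ∏ℚ s (λ j → ρ i j (C i j))
    0≤Zᵢ i = ∏ℚ-nonNeg s (λ j → 0≤ρ i j (C i j))
    η : ℚ
    η = ℕtoℚ (suc s) * ζ
    1-δ≤1-tη : 1ℚ - δ ≤ 1ℚ - ℕtoℚ t * η
    1-δ≤1-tη = ≤-by-difference (δ - ℕtoℚ t * η) (cancel δ (ℕtoℚ t * η)) (p≤q⇒0≤q-p t[1+s]ζ≤δ)
      where
      cancel : ∀ d x → 1ℚ - x - (1ℚ - d) ≡ d - x
      cancel = solve-∀ ℚ-ring
    row-bound : ∀ i → (1ℚ - η) * (1ℚ * ∏ℚ s (λ j → ρ i j (C i j))) ≤ β * ∏ℚ s (λ j → τ i j (C i j))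
    row-bound i = weierstrass (suc s)
      {a = λ { zero → β ; (suc j) → τ i j (C i j) }} {b = λ { zero → 1ℚ ; (suc j) → ρ i j (C i j) }} 0≤ζ ζ≤1
      (λ { zero → ℕtoℚ-nonNeg 1 ; (suc j) → 0≤ρ i j (C i j) })
      (λ { zero → [1-ζ]≤β ; (suc j) → [1-ζ]ρ≤τ i j (C i j) })

  scaled-product-bound : ∀ (C : Matrix k t s) m n →
    (1ℚ - δ) * ℕtoℚ m * ℕtoℚ n * ∏ℚ t (λ i → ∏ℚ s (λ j → ρ i j (C i j)))
      ≤ ∏ℚ t (λ i → β * ∏ℚ s (λ j → τ i j (C i j))) * ℕtoℚ m * ℕtoℚ n
  scaled-product-bound C m n = begin
    (1ℚ - δ) * ℕtoℚ m * ℕtoℚ n * Z      ≡⟨ regroup (1ℚ - δ) (ℕtoℚ m) (ℕtoℚ n) Z ⟩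
    (1ℚ - δ) * Z * (ℕtoℚ m * ℕtoℚ n)    ≤⟨ *-monoʳ-≤ _ (*-nonNeg (ℕtoℚ-nonNeg m) (ℕtoℚ-nonNeg n))
                                                       (product-bound C) ⟩
    W * (ℕtoℚ m * ℕtoℚ n)               ≡⟨ ℚP.*-assoc W (ℕtoℚ m) (ℕtoℚ n) ⟨
    W * ℕtoℚ m * ℕtoℚ n                 ∎
    where
    open ℚP.≤-Reasoning
    Z : ℚ
    Z = ∏ℚ t (λ i → ∏ℚ s (λ j → ρ i j (C i j)))
    W : ℚ
    W = ∏ℚ t (λ i → β * ∏ℚ s (λ j → τ i j (C i j)))
    regroup : ∀ a b c x → a * b * c * x ≡ a * x * (b * c)
    regroup = solve-∀ ℚ-ring

theorem4 : (k : ℕ) (δ : ℚ) → 0ℚ < δ → (t s : ℕ) (ρ : Fin t → Fin s → Fin k → ℚ) →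
    (∀ i j σ → 0ℚ < ρ i j σ × ρ i j σ ≤ 1ℚ) →
    ∃ λ (ε : ℚ) → 0ℚ < ε ×
      ((M N : ℕ) (A : Matrix k M N) (rowOf : Fin M → Fin t) (colOf : Fin N → Fin s) →
       (∀ i j → Regular ε A (part rowOf i) (part colOf j)) →
       (∀ i j σ → density A (part rowOf i) (part colOf j) σ ≡ ρ i j σ) →
       (C : Matrix k t s) →
       NumOccursAtLeast A C
         ((1ℚ - δ) * ℕtoℚ (∏ℕ t (λ i → ∣ part rowOf i ∣))
                   * ℕtoℚ (∏ℕ s (λ j → ∣ part colOf j ∣))
                   * ∏ℚ t (λ i → ∏ℚ s (λ j → ρ i j (C i j)))))
theorem4 k δ 0<δ t s ρ ρ-bounds = ε , 0<ε , λ M N A rowOf colOf regular density≡ρ C →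
  NumOccursAtLeast-mono {A = A}
    (scaled-product-bound C (∏ℕ t (λ i → ∣ part rowOf i ∣)) (∏ℕ s (λ j → ∣ part colOf j ∣)))
    (Greedy.occurrences A rowOf colOf C ε (λ i j → τ i j (C i j)) sε≤1
      (λ i j → 0≤τ i j (C i j)) (λ i j → τ≤1 i j (C i j))
      (λ i j → subst (λ d → τ i j (C i j) < d - ε) (sym (density≡ρ i j (C i j))) (τ<ρ-ε i j (C i j)))
      regular (ε≤∏τ C))
  where open Tolerance k δ 0<δ t s ρ ρ-bounds
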